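{- (i) For a prime power $q$ and an integer $n\ge 2$, say that $P_1(q,n)$ holds if: for every $\beta\in\mathbb{F}_q$, unless $(n,\beta)=(2,0)$ or $(n,q)=(3,4)$, there exists a primitive element $\xi\in\mathbb{F}_{q^n}$ with $\mathrm{Tr}_{q^n/q}(\xi)=\beta$. If $P_1(q,n)$ holds for all prime powers $q$ and all primes $n$, then $P_1(q,n)$ holds for all prime powers $q$ and all integers $n\ge 2$. (ii) For an odd prime power $q$ and an integer $n\ge 2$, say that $P_2(q,n)$ holds if: (a) when $n\ge 3$, for every $\beta\in\mathbb{F}_q$ there exists a $2$-primitive $\xi\in\mathbb{F}_{q^n}$ with $\mathrm{Tr}_{q^n/q}(\xi)=\beta$; (b) when $n=2$, for every $\beta\in\mathbb{F}_q^*$ there exists a $2$-primitive $\xi\in\mathbb{F}_{q^2}$ with $\mathrm{Tr}_{q^2/q}(\xi)=\beta$ unless $q\in\{3,5,7,9,11,13,31\}$, and moreover when $q=9$ and $\beta\in\{\pm1,\pm i\}$ (where $i\in\mathbb{F}_9$, $i^2=-1$) such a $2$-primitive $\xi\in\mathbb{F}_{81}$ with $\mathrm{Tr}_{81/9}(\xi)=\beta$ exists. If $P_2(q,n)$ holds for all odd prime powers $q$ and all primes $n$, then $P_2(q,n)$ holds for all odd prime powers $q$ and all integers $n\ge 2$.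
   Context: For a prime power $q$ and $n\ge1$, $\mathrm{Tr}_{q^n/q}:\mathbb{F}_{q^n}\to\mathbb{F}_q$ is the trace $\xi\mapsto\sum_{i=0}^{n-1}\xi^{q^i}$. An element of $\mathbb{F}_{q^n}$ is primitive if it has multiplicative order $q^n-1$, and $2$-primitive if it has multiplicative order $(q^n-1)/2$. -}

module Defs where

open import Data.Nat.DivMod using (_/_)

open import Level using (0ℓ)
open import Algebra.Bundles using (CommutativeRing)
open import Data.Nat as ℕ using (ℕ; zero; suc; _∸_; _≤_; _<_)
open import Data.Fin using (Fin)
open import Data.Product using (Σ; ∃; _×_; _,_)
open import Relation.Nullary using (¬_)
open import Relation.Binary.PropositionalEquality using (_≡_)

record FiniteField : Set₁ where
  field
    cring : CommutativeRing 0ℓ 0ℓ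
  open CommutativeRing cring public
  field
    0≉1     : ¬ (0# ≈ 1#)
    inverse : ∀ x → ¬ (x ≈ 0#) → ∃ λ y → x * y ≈ 1#
    size    : ℕ
    enum    : Fin size → Carrier
    enum-injective  : ∀ i j → enum i ≈ enum j → i ≡ j
    enum-surjective : ∀ x → ∃ λ i → enum i ≈ x

  infixr 8 _^_
  _^_ : Carrier → ℕ → Carrier
  x ^ zero  = 1#
  x ^ suc k = x * (x ^ k)

  sumTo : ℕ → (ℕ → Carrier) → Carrier
  sumTo zero    f = 0#
  sumTo (suc n) f = sumTo n f + f n

  HasOrder : Carrier → ℕ → Set
  HasOrder x k = (0 < k) × (x ^ k ≈ 1#) × (∀ j → 0 < j → j < k → ¬ (x ^ j ≈ 1#))

open FiniteField public using (size)

-- An embedding of the field K into the field L (a unital ring homomorphism;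
-- injectivity is automatic for fields).  L is then a field extension of K.
record Embedding (K L : FiniteField) : Set where
  private
    module K = FiniteField K
    module L = FiniteField L
  field
    ι      : K.Carrier → L.Carrier
    ι-cong : ∀ {x y} → x K.≈ y → ι x L.≈ ι y
    ι-+    : ∀ x y → ι (x K.+ y) L.≈ ι x L.+ ι y
    ι-*    : ∀ x y → ι (x K.* y) L.≈ ι x L.* ι y
    ι-1    : ι K.1# L.≈ L.1#

-- An extension L / K of degree n: an embedding with |L| = |K|^n,
-- i.e. (K, L) is a model of F_q ⊆ F_{q^n} with q = |K|.
record Extension (K L : FiniteField) (n : ℕ) : Set where
  field
    emb   : Embedding K L
    card  : size L ≡ size K ℕ.^ n
  open Embedding emb public

module _ {K L : FiniteField} {n : ℕ} (E : Extension K L n) where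
  private
    module K = FiniteField K
    module L = FiniteField L
  open Extension E

  -- Tr_{q^n/q}(ξ) = Σ_{i<n} ξ^{q^i}, viewed in L; "Tr ξ = β" means Tr ξ ≈ ι β.
  Tr : L.Carrier → L.Carrier
  Tr ξ = L.sumTo n (λ i → ξ L.^ (size K ℕ.^ i))

  HasTrace : L.Carrier → K.Carrier → Set
  HasTrace ξ β = Tr ξ L.≈ ι β

  Primitive : L.Carrier → Set
  Primitive ξ = L.HasOrder ξ (size L ∸ 1)

  TwoPrimitive : L.Carrier → Set
  TwoPrimitive ξ = L.HasOrder ξ ((size L ∸ 1) / 2)

  P₁ : Set
  P₁ = ∀ (β : K.Carrier) →
       ¬ (n ≡ 2 × β K.≈ K.0#) →
       ¬ (n ≡ 3 × size K ≡ 4) →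
       ∃ λ ξ → Primitive ξ × HasTrace ξ β

  Exceptional : ℕ → Set
  Exceptional q = q ≡ 3 ⊎' (q ≡ 5 ⊎' (q ≡ 7 ⊎' (q ≡ 9 ⊎' (q ≡ 11 ⊎' (q ≡ 13 ⊎' q ≡ 31)))))
    where open import Data.Sum using () renaming (_⊎_ to _⊎'_)

  P₂ : Set
  P₂ = (3 ≤ n → ∀ (β : K.Carrier) → ∃ λ ξ → TwoPrimitive ξ × HasTrace ξ β)
     × (n ≡ 2 → ¬ Exceptional (size K) →
          ∀ (β : K.Carrier) → ¬ (β K.≈ K.0#) → ∃ λ ξ → TwoPrimitive ξ × HasTrace ξ β)
     × (n ≡ 2 → size K ≡ 9 →
          ∀ (β : K.Carrier) →
          (β K.≈ K.1# ⊎ β K.≈ K.- K.1# ⊎ β K.* β K.≈ K.- K.1#) →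
          ∃ λ ξ → TwoPrimitive ξ × HasTrace ξ β)
    where open import Data.Sum using (_⊎_)

Odd : ℕ → Set
Odd q = ∃ λ k → q ≡ suc (2 ℕ.* k)

{-# OPTIONS --safe #-}
-- Write n = r·m with r prime and m ≥ 2, q = |K| and Q = q^m. Since q is a power of the
-- characteristic, x ↦ x^q is additive on L, so S = {x ∈ L | x^Q = x} is a subfield; it has
-- exactly Q elements, at most Q as roots of x^Q - x and at least Q because the trace L → S,
-- a polynomial of degree Q^(r-1), has fibres of at most that size. Thus K ⊆ S ⊆ L with
-- [L : S] = r prime, and Tr_{L/K} = Tr_{S/K} ∘ Tr_{L/S}. The trace S → K is K-linear, nonzero
-- (its degree q^(m-1) is below |S|) and has a nonzero kernel (|S| > |K|), so every β ∈ K is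
-- Tr_{S/K}(γ) for some γ ≠ 0 in S. The prime-degree statement for L/S yields a primitive
-- (resp. 2-primitive) ξ with Tr_{L/S}(ξ) = γ, hence Tr_{L/K}(ξ) = β; primitivity only refers
-- to L. The exceptions are avoided: for P₁ by taking r = 2 whenever n is even; for P₂ since
-- the exceptional sizes other than 9 are prime while Q = q^m is not, and for L/S = 𝔽₈₁/𝔽₉ by
-- taking γ ∈ {±1, ±i}, whose traces ±1 + (±1)³ = ∓1 and i + i³ = 0 cover 𝔽₃.
module Submission where

open import Defs
open import Data.Nat using (ℕ; _≤_; _<_; NonZero)
open import Data.Nat.Primality using (Prime)
open import Data.Product using (Σ; ∃; _×_; _,_; proj₁; proj₂)

open import Level using (0ℓ)
open import Algebra.Bundles using (CommutativeRing)
open import Relation.Binary.Bundles using (Setoid; DecSetoid)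
open import Relation.Binary.PropositionalEquality using (_≡_)

module NatFacts where

  open import Data.Nat as ℕ using (zero; suc; _<_; _∸_; _!; z≤n; s≤s)
  import Data.Nat.Properties as ℕ
  open import Data.Nat.Divisibility using (_∣_; _∣?_; divides; ∣1⇒≡1; ∣⇒≤)
  open import Data.Nat.Divisibility.Core using (hasNonTrivialDivisor)
  open import Data.Nat.DivMod using (m/n*n≡m)
  open import Data.Nat.Primality using (prime; prime[2]; ¬prime[1]; euclidsLemma; prime⇒nonZero)
  open import Data.Nat.Primality.Factorisation using (factorise)
  open import Data.List using ([]; _∷_)
  open import Data.Nat.ListAction using (product)
  open import Data.List.Relation.Unary.All using (_∷_)
  open import Data.Nat.Combinatorics using (_C_; nCk≡n!/k![n-k]!; k![n∸k]!∣n!)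
  open import Data.Sum using (_⊎_; inj₁; inj₂; [_,_]′)
  open import Data.Empty using (⊥-elim)
  open import Relation.Nullary using (¬_; yes; no)
  open import Relation.Unary using (Pred; Decidable)
  open import Relation.Binary.PropositionalEquality as ≡ using (_≡_)

  least? : {P : Pred ℕ 0ℓ} → Decidable P → ∀ n →
           (∀ j → j < n → ¬ P j) ⊎ ∃ λ k → k < n × P k × (∀ j → j < k → ¬ P j)
  least? P? zero = inj₁ λ _ ()
  least? P? (suc n) with least? P? n
  ... | inj₂ (k , k<n , Pk , below) = inj₂ (k , ℕ.m≤n⇒m≤1+n k<n , Pk , below)
  ... | inj₁ none with P? n
  ...   | yes Pn = inj₂ (n , ℕ.≤-refl , Pn , none)
  ...   | no ¬Pn = inj₁ λ j j<1+n → [ none j , (λ { ≡.refl → ¬Pn }) ]′ (ℕ.m≤n⇒m<n∨m≡n (ℕ.≤-pred j<1+n))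

  prime∤m! : ∀ {p} → Prime p → ∀ m → m < p → ¬ p ∣ m !
  prime∤m! pp zero _ p∣1 with ∣1⇒≡1 p∣1
  ... | ≡.refl = ¬prime[1] pp
  prime∤m! pp (suc m) 1+m<p p∣[1+m]! with euclidsLemma (suc m) (m !) pp p∣[1+m]!
  ... | inj₁ p∣1+m = ℕ.<-irrefl ≡.refl (ℕ.<-≤-trans 1+m<p (∣⇒≤ p∣1+m))
  ... | inj₂ p∣m! = prime∤m! pp m (ℕ.<-trans (ℕ.n<1+n m) 1+m<p) p∣m!

  p∣pCk : ∀ {p k} → Prime p → 0 < k → k < p → p ∣ p C k
  p∣pCk {p} {k} pp 0<k k<p with euclidsLemma (p C k) (k ! ℕ.* (p ∸ k) !) pp p∣pCk*k!*[p-k]!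
    where
    instance _ = k ℕ.!* (p ∸ k) !≢0
    n∣n! : ∀ n → .{{ℕ.NonZero n}} → n ∣ n !
    n∣n! (suc n) = divides (n !) (ℕ.*-comm (suc n) (n !))
    p∣pCk*k!*[p-k]! : p ∣ (p C k) ℕ.* (k ! ℕ.* (p ∸ k) !)
    p∣pCk*k!*[p-k]! = ≡.subst (p ∣_)
      (≡.sym (≡.trans (≡.cong (ℕ._* (k ! ℕ.* (p ∸ k) !)) (nCk≡n!/k![n-k]! (ℕ.<⇒≤ k<p)))
                      (m/n*n≡m (k![n∸k]!∣n! (ℕ.<⇒≤ k<p)))))
      (n∣n! p {{prime⇒nonZero pp}})
  ... | inj₁ p∣pCk = p∣pCk
  ... | inj₂ p∣k!*[p-k]! with euclidsLemma (k !) ((p ∸ k) !) pp p∣k!*[p-k]!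
  ...   | inj₁ p∣k! = ⊥-elim (prime∤m! pp k k<p p∣k!)
  ...   | inj₂ p∣[p-k]! = ⊥-elim (prime∤m! pp (p ∸ k) (ℕ.∸-monoʳ-< {p} {k} {0} 0<k (ℕ.<⇒≤ k<p)) p∣[p-k]!)

  cofactor≥2 : ∀ {r m n} → 2 ≤ n → ¬ Prime n → Prime r → n ≡ r ℕ.* m → 2 ≤ m
  cofactor≥2 {r} {zero} 2≤n _ _ n≡r*0 = ⊥-elim (ℕ.<⇒≱ 2≤n (ℕ.≤-trans (ℕ.≤-reflexive (≡.trans n≡r*0 (ℕ.*-zeroʳ r))) z≤n))
  cofactor≥2 {r} {1} _ ¬n-prime r-prime n≡r*1 = ⊥-elim (¬n-prime (≡.subst Prime (≡.sym (≡.trans n≡r*1 (ℕ.*-identityʳ r))) r-prime))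
  cofactor≥2 {m = suc (suc m)} _ _ _ _ = s≤s (s≤s z≤n)

  composite-factorisation : ∀ {n} → 2 ≤ n → ¬ Prime n → ∃ λ r → ∃ λ m → Prime r × 2 ≤ m × n ≡ r ℕ.* m
  composite-factorisation {n} 2≤n ¬n-prime with factorise n {{ℕ.>-nonZero (ℕ.<-trans (s≤s z≤n) 2≤n)}}
  ... | record { factors = [] ; isFactorisation = n≡1 } = ⊥-elim (ℕ.<⇒≱ 2≤n (ℕ.≤-reflexive n≡1))
  ... | record { factors = r ∷ rs ; isFactorisation = n≡r*Πrs ; factorsPrime = r-prime ∷ _ } =
    r , product rs , r-prime , cofactor≥2 2≤n ¬n-prime r-prime n≡r*Πrs , n≡r*Πrs

  -- The excluded case (r, |S|) = (3, 4) of P₁ arises only for n = 6, so even n are split as 2·m.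
  composite-factorisation′ : ∀ {n} → 2 ≤ n → ¬ Prime n →
    ∃ λ r → ∃ λ m → Prime r × 2 ≤ m × n ≡ r ℕ.* m × (r ≡ 2 ⊎ ¬ 2 ∣ n)
  composite-factorisation′ {n} 2≤n ¬n-prime with 2 ∣? n
  ... | yes (divides m n≡m*2) = 2 , m , prime[2] , cofactor≥2 2≤n ¬n-prime prime[2] n≡2*m , n≡2*m , inj₁ ≡.refl
    where n≡2*m = ≡.trans n≡m*2 (ℕ.*-comm m 2)
  ... | no 2∤n with composite-factorisation 2≤n ¬n-prime
  ...   | r , m , r-prime , 2≤m , n≡r*m = r , m , r-prime , 2≤m , n≡r*m , inj₂ 2∤n

  ^-¬prime : ∀ {q m} → 2 ≤ q → 2 ≤ m → ¬ Prime (q ℕ.^ m)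
  ^-¬prime {q} {suc m} 2≤q (s≤s 1≤m) (prime ¬composite) = ¬composite
    (hasNonTrivialDivisor {{ℕ.n>1⇒nonTrivial 2≤q}} q<q^[1+m] (divides (q ℕ.^ m) (ℕ.*-comm q (q ℕ.^ m))))
    where
    instance _ = ℕ.>-nonZero (ℕ.<-trans (s≤s z≤n) 2≤q)
    q<q^[1+m] : q < q ℕ.^ suc m
    q<q^[1+m] = ℕ.≤-<-trans (ℕ.≤-reflexive (≡.sym (ℕ.*-identityʳ q))) (ℕ.^-monoʳ-< q 2≤q (s≤s 1≤m))

  q^m≡4⇒m≡2 : ∀ {q m} → 2 ≤ q → 2 ≤ m → q ℕ.^ m ≡ 4 → m ≡ 2
  q^m≡4⇒m≡2 {m = 1} _ (s≤s ()) _
  q^m≡4⇒m≡2 {m = 2} _ _ _ = ≡.refl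
  q^m≡4⇒m≡2 {q} {suc (suc (suc m))} 2≤q _ q^m≡4 = ⊥-elim (ℕ.<⇒≱ (ℕ.m<n+m 4 {4} (s≤s z≤n)) (begin
    8                              ≤⟨ ℕ.^-monoʳ-≤ 2 {3} {3 ℕ.+ m} (ℕ.m≤m+n 3 m) ⟩
    2 ℕ.^ (3 ℕ.+ m)                ≤⟨ ℕ.^-monoˡ-≤ (3 ℕ.+ m) 2≤q ⟩
    q ℕ.^ (3 ℕ.+ m)                ≡⟨ q^m≡4 ⟩
    4                              ∎))
    where open ℕ.≤-Reasoning

  q^m≡9⇒q≡3∧m≡2 : ∀ {q m} → 3 ≤ q → 2 ≤ m → q ℕ.^ m ≡ 9 → q ≡ 3 × m ≡ 2
  q^m≡9⇒q≡3∧m≡2 {m = 1} _ (s≤s ()) _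
  q^m≡9⇒q≡3∧m≡2 {3} {2} _ _ _ = ≡.refl , ≡.refl
  q^m≡9⇒q≡3∧m≡2 {suc (suc (suc (suc q)))} {2} _ _ q²≡9 = ⊥-elim (ℕ.<⇒≱ (ℕ.m<n+m 9 {7} (s≤s z≤n)) (begin
    16                             ≤⟨ ℕ.^-monoˡ-≤ 2 {4} {4 ℕ.+ q} (ℕ.m≤m+n 4 q) ⟩
    (4 ℕ.+ q) ℕ.^ 2                ≡⟨ q²≡9 ⟩
    9                              ∎))
    where open ℕ.≤-Reasoning
  q^m≡9⇒q≡3∧m≡2 {q} {suc (suc (suc m))} 3≤q _ q^m≡9 = ⊥-elim (ℕ.<⇒≱ (ℕ.m<n+m 9 {18} (s≤s z≤n)) (begin
    27                             ≤⟨ ℕ.^-monoʳ-≤ 3 {3} {3 ℕ.+ m} (ℕ.m≤m+n 3 m) ⟩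
    3 ℕ.^ (3 ℕ.+ m)                ≤⟨ ℕ.^-monoˡ-≤ (3 ℕ.+ m) 3≤q ⟩
    q ℕ.^ (3 ℕ.+ m)                ≡⟨ q^m≡9 ⟩
    9                              ∎))
    where open ℕ.≤-Reasoning

  Odd-* : ∀ {a b} → Odd a → Odd b → Odd (a ℕ.* b)
  Odd-* (i , ≡.refl) (j , ≡.refl) = i ℕ.+ j ℕ.+ 2 ℕ.* (i ℕ.* j) , identity i j
    where
    open import Data.Nat.Tactic.RingSolver using (solve-∀)
    identity : ∀ i j → suc (2 ℕ.* i) ℕ.* suc (2 ℕ.* j) ≡ suc (2 ℕ.* (i ℕ.+ j ℕ.+ 2 ℕ.* (i ℕ.* j)))
    identity = solve-∀

  Odd-^ : ∀ {q} → Odd q → ∀ m → Odd (q ℕ.^ m)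
  Odd-^ _ zero = 0 , ≡.refl
  Odd-^ q-odd (suc m) = Odd-* q-odd (Odd-^ q-odd m)

  Odd∧2≤⇒3≤ : ∀ {q} → Odd q → 2 ≤ q → 3 ≤ q
  Odd∧2≤⇒3≤ (zero , ≡.refl) (s≤s ())
  Odd∧2≤⇒3≤ (suc k , ≡.refl) _ = s≤s (ℕ.*-monoʳ-≤ 2 (s≤s (z≤n {k})))

module IntegerRingSolver (R : CommutativeRing 0ℓ 0ℓ) where

  open import Data.Nat as ℕ using (zero; suc)
  import Data.Nat.Properties as ℕ
  open import Data.Integer as ℤ using (ℤ; +_; -[1+_]; _⊖_; _◃_)
  import Data.Integer.Properties as ℤ
  open import Data.Sign as Sign using (Sign)
  open import Data.Maybe using (Maybe; just; nothing)
  open import Relation.Binary.PropositionalEquality as ≡ using (_≡_)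
  open import Relation.Nullary using (yes; no)
  open import Algebra.Solver.Ring.AlmostCommutativeRing
    using (AlmostCommutativeRing; fromCommutativeRing; _-Raw-AlmostCommutative⟶_)

  open CommutativeRing R
  open import Algebra.Properties.Ring ring
    using (-‿involutive; -‿distribˡ-*; -‿distribʳ-*; -‿+-comm; -0#≈0#)
  open import Algebra.Properties.Semiring.Mult semiring using (×-homo-+; ×1-homo-*)
    renaming (_×_ to _·_)
  open import Relation.Binary.Reasoning.Setoid setoid

  ⟦_⟧ℤ : ℤ → Carrier
  ⟦ + n ⟧ℤ = n · 1#
  ⟦ -[1+ n ] ⟧ℤ = - (suc n · 1#)

  private
    signed : Sign → Carrier → Carrier
    signed Sign.+ x = x
    signed Sign.- x = - x

    signed-cong : ∀ s {x y} → x ≈ y → signed s x ≈ signed s y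
    signed-cong Sign.+ x≈y = x≈y
    signed-cong Sign.- x≈y = -‿cong x≈y

    signed-* : ∀ s t x y → signed (s Sign.* t) (x * y) ≈ signed s x * signed t y
    signed-* Sign.+ Sign.+ x y = refl
    signed-* Sign.+ Sign.- x y = -‿distribʳ-* x y
    signed-* Sign.- Sign.+ x y = -‿distribˡ-* x y
    signed-* Sign.- Sign.- x y = begin
      x * y         ≈⟨ -‿involutive (x * y) ⟨
      - - (x * y)   ≈⟨ -‿cong (-‿distribˡ-* x y) ⟩
      - (- x * y)   ≈⟨ -‿distribʳ-* (- x) y ⟩
      - x * - y     ∎

    ⟦◃⟧ : ∀ s n → ⟦ s ◃ n ⟧ℤ ≈ signed s (n · 1#)
    ⟦◃⟧ Sign.+ zero = refl
    ⟦◃⟧ Sign.- zero = sym -0#≈0#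
    ⟦◃⟧ Sign.+ (suc n) = refl
    ⟦◃⟧ Sign.- (suc n) = refl

    ⟦sign◃∣∣⟧ : ∀ i → ⟦ i ⟧ℤ ≈ signed (ℤ.sign i) (ℤ.∣ i ∣ · 1#)
    ⟦sign◃∣∣⟧ (+ n) = refl
    ⟦sign◃∣∣⟧ -[1+ n ] = refl

    1+x-[1+y]≈x-y : ∀ x y → (1# + x) - (1# + y) ≈ x - y
    1+x-[1+y]≈x-y x y = begin
      (1# + x) - (1# + y)       ≈⟨ +-congˡ (-‿+-comm 1# y) ⟨
      (1# + x) + (- 1# - y)     ≈⟨ +-assoc 1# x (- 1# - y) ⟩
      1# + (x + (- 1# - y))     ≈⟨ +-congˡ (+-assoc x (- 1#) (- y)) ⟨
      1# + ((x - 1#) - y)       ≈⟨ +-congˡ (+-congʳ (+-comm x (- 1#))) ⟩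
      1# + ((- 1# + x) - y)     ≈⟨ +-congˡ (+-assoc (- 1#) x (- y)) ⟩
      1# + (- 1# + (x - y))     ≈⟨ +-assoc 1# (- 1#) (x - y) ⟨
      (1# - 1#) + (x - y)       ≈⟨ +-congʳ (-‿inverseʳ 1#) ⟩
      0# + (x - y)              ≈⟨ +-identityˡ (x - y) ⟩
      x - y                     ∎

    ⟦⊖⟧ : ∀ m n → ⟦ m ⊖ n ⟧ℤ ≈ m · 1# - n · 1#
    ⟦⊖⟧ m zero = begin
      ⟦ m ⊖ 0 ⟧ℤ        ≡⟨⟩
      m · 1#            ≈⟨ +-identityʳ (m · 1#) ⟨
      m · 1# + 0#       ≈⟨ +-congˡ -0#≈0# ⟨
      m · 1# - 0#       ∎
    ⟦⊖⟧ zero (suc n) = begin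
      ⟦ 0 ⊖ suc n ⟧ℤ    ≡⟨⟩
      - (suc n · 1#)    ≈⟨ +-identityˡ _ ⟨
      0# - suc n · 1#   ∎
    ⟦⊖⟧ (suc m) (suc n) = begin
      ⟦ suc m ⊖ suc n ⟧ℤ             ≡⟨ ≡.cong ⟦_⟧ℤ (ℤ.[1+m]⊖[1+n]≡m⊖n m n) ⟩
      ⟦ m ⊖ n ⟧ℤ                     ≈⟨ ⟦⊖⟧ m n ⟩
      m · 1# - n · 1#                ≈⟨ 1+x-[1+y]≈x-y (m · 1#) (n · 1#) ⟨
      suc m · 1# - suc n · 1#        ∎

    ⟦+⟧ : ∀ i j → ⟦ i ℤ.+ j ⟧ℤ ≈ ⟦ i ⟧ℤ + ⟦ j ⟧ℤ
    ⟦+⟧ (+ m) (+ n) = ×-homo-+ 1# m n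
    ⟦+⟧ (+ m) -[1+ n ] = ⟦⊖⟧ m (suc n)
    ⟦+⟧ -[1+ m ] (+ n) = trans (⟦⊖⟧ n (suc m)) (+-comm _ _)
    ⟦+⟧ -[1+ m ] -[1+ n ] = begin
      - (suc (suc (m ℕ.+ n)) · 1#)        ≡⟨ ≡.cong (λ k → - (suc k · 1#)) (ℕ.+-suc m n) ⟨
      - ((suc m ℕ.+ suc n) · 1#)          ≈⟨ -‿cong (×-homo-+ 1# (suc m) (suc n)) ⟩
      - (suc m · 1# + suc n · 1#)         ≈⟨ -‿+-comm _ _ ⟨
      - (suc m · 1#) + - (suc n · 1#)     ∎

    ⟦*⟧ : ∀ i j → ⟦ i ℤ.* j ⟧ℤ ≈ ⟦ i ⟧ℤ * ⟦ j ⟧ℤ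
    ⟦*⟧ i j = begin
      ⟦ (s Sign.* t) ◃ (a ℕ.* b) ⟧ℤ               ≈⟨ ⟦◃⟧ (s Sign.* t) (a ℕ.* b) ⟩
      signed (s Sign.* t) ((a ℕ.* b) · 1#)        ≈⟨ signed-cong (s Sign.* t) (×1-homo-* a b) ⟩
      signed (s Sign.* t) (a · 1# * b · 1#)       ≈⟨ signed-* s t _ _ ⟩
      signed s (a · 1#) * signed t (b · 1#)       ≈⟨ *-cong (⟦sign◃∣∣⟧ i) (⟦sign◃∣∣⟧ j) ⟨
      ⟦ i ⟧ℤ * ⟦ j ⟧ℤ                             ∎
      where
      s = ℤ.sign i
      t = ℤ.sign j
      a = ℤ.∣ i ∣
      b = ℤ.∣ j ∣

    ⟦-⟧ : ∀ i → ⟦ ℤ.- i ⟧ℤ ≈ - ⟦ i ⟧ℤ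
    ⟦-⟧ -[1+ n ] = sym (-‿involutive _)
    ⟦-⟧ (+ zero) = sym -0#≈0#
    ⟦-⟧ (+ suc n) = refl

    ACR : AlmostCommutativeRing 0ℓ 0ℓ
    ACR = fromCommutativeRing R

    ⟦⟧-morphism : ℤ.+-*-rawRing -Raw-AlmostCommutative⟶ ACR
    ⟦⟧-morphism = record
      { ⟦_⟧ = ⟦_⟧ℤ ; +-homo = ⟦+⟧ ; *-homo = ⟦*⟧ ; -‿homo = ⟦-⟧
      ; 0-homo = refl ; 1-homo = +-identityʳ 1# }

    ⟦⟧-≟ : ∀ i j → Maybe (⟦ i ⟧ℤ ≈ ⟦ j ⟧ℤ)
    ⟦⟧-≟ i j with i ℤ.≟ j
    ... | yes ≡.refl = just refl
    ... | no _ = nothing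

  open import Algebra.Solver.Ring ℤ.+-*-rawRing ACR ⟦⟧-morphism ⟦⟧-≟ public
    using (solve; _:=_; _:+_; _:*_; :-_; _:-_; con)

module UniqueLists (S : Setoid 0ℓ 0ℓ) where

  open import Data.Nat as ℕ using (suc; z≤n; s≤s)
  import Data.Nat.Properties as ℕ
  open import Data.Fin as Fin using (Fin)
  import Data.List.Membership.Propositional.Properties as ∈ₚ
  open import Data.List using (List; []; _∷_; length; filter; lookup)
  open import Data.List.Relation.Unary.Any using (here; there; _─_)
  open import Data.List.Relation.Unary.All as All using (All; []; _∷_)
  import Data.List.Relation.Unary.All.Properties as All
  open import Data.List.Relation.Unary.AllPairs as AllPairs using ([]; _∷_)
  open import Data.Empty using (⊥-elim)
  open import Data.Sum using (_⊎_; inj₁; inj₂)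
  open import Relation.Nullary using (¬_; yes; no)
  open import Relation.Unary using (Pred; Decidable)
  open import Relation.Unary.Properties using (∁?)
  open import Relation.Binary.PropositionalEquality as ≡ using (_≡_)

  open Setoid S renaming (Carrier to A)
  open import Data.List.Membership.Setoid S public using (_∈_; _∉_; find)
  open import Data.List.Relation.Unary.Unique.Setoid S public using (Unique)
  open import Data.List.Relation.Binary.Subset.Setoid S public using (_⊆_)
  import Data.List.Membership.Setoid.Properties as ∈
  import Data.List.Relation.Unary.Unique.Setoid.Properties as Unique

  ∈-resp-≈ : ∀ {xs x y} → x ≈ y → x ∈ xs → y ∈ xs
  ∈-resp-≈ = ∈.∈-resp-≈ S

  length-─ : ∀ {x xs} (x∈xs : x ∈ xs) → suc (length (xs ─ x∈xs)) ≡ length xs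
  length-─ (here _) = ≡.refl
  length-─ (there x∈xs) = ≡.cong suc (length-─ x∈xs)

  ∈-─⁺ : ∀ {x y xs} (x∈xs : x ∈ xs) → y ∈ xs → y ≉ x → y ∈ (xs ─ x∈xs)
  ∈-─⁺ (here x≈z) (here y≈z) y≉x = ⊥-elim (y≉x (trans y≈z (sym x≈z)))
  ∈-─⁺ (here _) (there y∈xs) _ = y∈xs
  ∈-─⁺ (there _) (here y≈z) _ = here y≈z
  ∈-─⁺ (there x∈xs) (there y∈xs) y≉x = there (∈-─⁺ x∈xs y∈xs y≉x)

  All-─ : ∀ {P : Pred A 0ℓ} {x xs} (x∈xs : x ∈ xs) → All P xs → All P (xs ─ x∈xs)
  All-─ (here _) (_ ∷ pxs) = pxs
  All-─ (there x∈xs) (pz ∷ pxs) = pz ∷ All-─ x∈xs pxs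

  ─-Unique : ∀ {x xs} (x∈xs : x ∈ xs) → Unique xs → Unique (xs ─ x∈xs)
  ─-Unique (here _) (_ ∷ xs!) = xs!
  ─-Unique (there x∈xs) (z≉ ∷ xs!) = All-─ x∈xs z≉ ∷ ─-Unique x∈xs xs!

  ∈-─⇒≉ : ∀ {x y xs} (x∈xs : x ∈ xs) → Unique xs → y ∈ (xs ─ x∈xs) → y ≉ x
  ∈-─⇒≉ (here x≈z) (z≉ ∷ _) y∈ y≈x =
    ∈.All[≉]⇒∉ S z≉ (∈-resp-≈ (trans y≈x x≈z) y∈)
  ∈-─⇒≉ (there x∈xs) (z≉ ∷ _) (here y≈z) y≈x =
    ∈.All[≉]⇒∉ S z≉ (∈-resp-≈ (trans (sym y≈x) y≈z) x∈xs)
  ∈-─⇒≉ (there x∈xs) (_ ∷ xs!) (there y∈) = ∈-─⇒≉ x∈xs xs! y∈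

  ∷⊆⇒⊆─ : ∀ {x xs ys} → Unique (x ∷ xs) → (x∷xs⊆ys : (x ∷ xs) ⊆ ys) → xs ⊆ (ys ─ x∷xs⊆ys (here refl))
  ∷⊆⇒⊆─ (x≉ ∷ _) x∷xs⊆ys y∈xs = ∈-─⁺ (x∷xs⊆ys (here refl)) (x∷xs⊆ys (there y∈xs)) λ y≈x →
    ∈.All[≉]⇒∉ S x≉ (∈-resp-≈ y≈x y∈xs)

  Unique∧⊆⇒length≤ : ∀ {xs ys} → Unique xs → xs ⊆ ys → length xs ℕ.≤ length ys
  Unique∧⊆⇒length≤ {[]} _ _ = z≤n
  Unique∧⊆⇒length≤ {x ∷ xs} {ys} x∷xs! x∷xs⊆ys = begin
    suc (length xs)           ≤⟨ s≤s (Unique∧⊆⇒length≤ (AllPairs.tail x∷xs!) (∷⊆⇒⊆─ x∷xs! x∷xs⊆ys)) ⟩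
    suc (length (ys ─ x∈ys))  ≡⟨ length-─ x∈ys ⟩
    length ys                 ∎
    where
    open ℕ.≤-Reasoning
    x∈ys = x∷xs⊆ys (here refl)

  length-filter+length-filter-∁ : ∀ {P : Pred A 0ℓ} (P? : Decidable P) xs →
    length (filter P? xs) ℕ.+ length (filter (∁? P?) xs) ≡ length xs
  length-filter+length-filter-∁ P? [] = ≡.refl
  length-filter+length-filter-∁ P? (x ∷ xs) with P? x
  ... | yes _ = ≡.cong suc (length-filter+length-filter-∁ P? xs)
  ... | no _ = ≡.trans (ℕ.+-suc _ _) (≡.cong suc (length-filter+length-filter-∁ P? xs))

  All-or-counterexample : ∀ {P : Pred A 0ℓ} → Decidable P → ∀ xs → All P xs ⊎ ∃ λ x → x ∈ xs × ¬ P x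
  All-or-counterexample P? xs with All.all? P? xs
  ... | yes all = inj₁ all
  ... | no ¬all = inj₂ (find (All.¬All⇒Any¬ P? xs ¬all))

  lookup-injective : ∀ {xs} → Unique xs → ∀ {i j} → lookup xs i ≈ lookup xs j → i ≡ j
  lookup-injective (_ ∷ _) {Fin.zero} {Fin.zero} _ = ≡.refl
  lookup-injective (x≉ ∷ _) {Fin.zero} {Fin.suc j} x≈ = ⊥-elim (All.lookup x≉ (∈ₚ.∈-lookup {xs = _} j) x≈)
  lookup-injective (x≉ ∷ _) {Fin.suc i} {Fin.zero} ≈x = ⊥-elim (All.lookup x≉ (∈ₚ.∈-lookup {xs = _} i) (sym ≈x))
  lookup-injective (_ ∷ xs!) {Fin.suc i} {Fin.suc j} e = ≡.cong Fin.suc (lookup-injective xs! e)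

module FiniteFieldProperties (F : FiniteField) where

  open import Data.Nat as ℕ using (zero; suc; _<_; z≤n; s≤s)
  import Data.Nat.Properties as ℕ
  open import Data.Fin as Fin using (Fin)
  open import Data.List using (List; []; _∷_; length; map; tabulate; foldr; filter)
  import Data.List.Properties as List
  open import Data.List.Relation.Unary.Any using (here; there; _─_)
  open import Data.List.Relation.Unary.All as All using (All; []; _∷_)
  open import Data.List.Relation.Unary.AllPairs using ([]; _∷_)
  open import Data.Sum using (_⊎_; inj₁; inj₂)
  open import Data.Empty using (⊥-elim)
  open import Relation.Nullary using (¬_; yes; no)
  open import Relation.Binary using (Decidable)
  open import Relation.Unary using (Pred) renaming (Decidable to Decidable₁)
  import Data.List.Relation.Unary.All.Properties as All
  open import Relation.Unary.Properties using (∁?)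
  open import Relation.Binary.PropositionalEquality as ≡ using (_≡_)
  import Data.List.Membership.Setoid.Properties as ∈
  import Data.List.Relation.Unary.Unique.Setoid.Properties as Unique

  open FiniteField F hiding (size)
  open IntegerRingSolver cring public
  open import Relation.Binary.Reasoning.Setoid setoid

  q : ℕ
  q = FiniteField.size F

  infix 4 _≟_
  _≟_ : Decidable _≈_
  x ≟ y with enum-surjective x | enum-surjective y
  ... | i , i↦x | j , j↦y with i Fin.≟ j
  ...   | yes ≡.refl = yes (trans (sym i↦x) j↦y)
  ...   | no i≢j = no λ x≈y → i≢j (enum-injective i j (trans i↦x (trans x≈y (sym j↦y))))

  decSetoid : DecSetoid 0ℓ 0ℓ
  decSetoid = record { isDecEquivalence = record { isEquivalence = isEquivalence ; _≟_ = _≟_ } }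

  open UniqueLists setoid public
  open import Data.List.Membership.DecSetoid decSetoid public using (_∈?_)

  elements : List Carrier
  elements = tabulate enum

  ∈-elements : ∀ x → x ∈ elements
  ∈-elements x with enum-surjective x
  ... | i , i↦x = ∈-resp-≈ i↦x (∈.∈-tabulate⁺ setoid i)

  elements-Unique : Unique elements
  elements-Unique = Unique.tabulate⁺ setoid (enum-injective _ _)

  length-elements : length elements ≡ q
  length-elements = List.length-tabulate enum

  Unique⇒length≤q : ∀ {xs} → Unique xs → length xs ℕ.≤ q
  Unique⇒length≤q xs! = ℕ.≤-trans (Unique∧⊆⇒length≤ xs! (λ {x} _ → ∈-elements x))
                                  (ℕ.≤-reflexive length-elements)

  Unique⇒length≤length*fibre : (f : Carrier → Carrier) (d : ℕ) →
    (∀ y {xs} → Unique xs → All (λ x → f x ≈ y) xs → length xs ℕ.≤ d) →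
    ∀ ys {xs} → Unique xs → All (λ x → f x ∈ ys) xs → length xs ℕ.≤ length ys ℕ.* d
  Unique⇒length≤length*fibre f d fibre [] {[]} _ _ = z≤n
  Unique⇒length≤length*fibre f d fibre [] {_ ∷ _} _ (() ∷ _)
  Unique⇒length≤length*fibre f d fibre (y ∷ ys) {xs} xs! fxs∈ = ℕ.≤-trans
    (ℕ.≤-reflexive (≡.sym (length-filter+length-filter-∁ P? xs)))
    (ℕ.+-mono-≤ (fibre y (Unique.filter⁺ setoid P? xs!) (All.all-filter P? xs))
                (Unique⇒length≤length*fibre f d fibre ys (Unique.filter⁺ setoid (∁? P?) xs!) rest))
    where
    P : Pred Carrier 0ℓ
    P x = f x ≈ y
    P? : Decidable₁ P
    P? x = f x ≟ y
    fx∈ys : ∀ {x} → f x ∈ (y ∷ ys) → ¬ P x → f x ∈ ys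
    fx∈ys (here fx≈y) fx≉y = ⊥-elim (fx≉y fx≈y)
    fx∈ys (there fx∈ys) _ = fx∈ys
    rest : All (λ x → f x ∈ ys) (filter (∁? P?) xs)
    rest = All.zipWith (λ (fx∈ , fx≉y) → fx∈ys fx∈ fx≉y)
             (All.filter⁺ (∁? P?) fxs∈ , All.all-filter (∁? P?) xs)


  1≉0 : 1# ≉ 0#
  1≉0 1≈0 = 0≉1 (sym 1≈0)

  2≤q : 2 ℕ.≤ q
  2≤q = Unique⇒length≤q {0# ∷ 1# ∷ []} ((0≉1 ∷ []) ∷ [] ∷ [])

  ^-cong : ∀ {x y} k → x ≈ y → x ^ k ≈ y ^ k
  ^-cong zero _ = refl
  ^-cong (suc k) x≈y = *-cong x≈y (^-cong k x≈y)

  1^n≈1 : ∀ n → 1# ^ n ≈ 1#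
  1^n≈1 zero = refl
  1^n≈1 (suc n) = trans (*-identityˡ _) (1^n≈1 n)

  0^[1+n]≈0 : ∀ n → 0# ^ suc n ≈ 0#
  0^[1+n]≈0 n = zeroˡ _

  ^-distribˡ-+-* : ∀ x a b → x ^ (a ℕ.+ b) ≈ x ^ a * x ^ b
  ^-distribˡ-+-* x zero b = sym (*-identityˡ _)
  ^-distribˡ-+-* x (suc a) b = trans (*-congˡ (^-distribˡ-+-* x a b)) (sym (*-assoc _ _ _))

  ^-distribʳ-* : ∀ x y k → (x * y) ^ k ≈ x ^ k * y ^ k
  ^-distribʳ-* x y zero = sym (*-identityˡ _)
  ^-distribʳ-* x y (suc k) = begin
    (x * y) * (x * y) ^ k         ≈⟨ *-congˡ (^-distribʳ-* x y k) ⟩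
    (x * y) * (x ^ k * y ^ k)     ≈⟨ solve 4 (λ a b c d → (a :* b) :* (c :* d) := (a :* c) :* (b :* d))
                                          refl x y (x ^ k) (y ^ k) ⟩
    (x * x ^ k) * (y * y ^ k)     ∎

  ^-*-assoc : ∀ x a b → (x ^ a) ^ b ≈ x ^ (a ℕ.* b)
  ^-*-assoc x zero b = 1^n≈1 b
  ^-*-assoc x (suc a) b = begin
    (x * x ^ a) ^ b               ≈⟨ ^-distribʳ-* x (x ^ a) b ⟩
    x ^ b * (x ^ a) ^ b           ≈⟨ *-congˡ (^-*-assoc x a b) ⟩
    x ^ b * x ^ (a ℕ.* b)         ≈⟨ ^-distribˡ-+-* x b (a ℕ.* b) ⟨
    x ^ (b ℕ.+ a ℕ.* b)           ∎

  x^k≈x⇒x^k^j≈x : ∀ {x} k → x ^ k ≈ x → ∀ j → x ^ (k ℕ.^ j) ≈ x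
  x^k≈x⇒x^k^j≈x k _ zero = *-identityʳ _
  x^k≈x⇒x^k^j≈x {x} k x^k≈x (suc j) = begin
    x ^ (k ℕ.* k ℕ.^ j)       ≈⟨ ^-*-assoc x k (k ℕ.^ j) ⟨
    (x ^ k) ^ (k ℕ.^ j)       ≈⟨ ^-cong (k ℕ.^ j) x^k≈x ⟩
    x ^ (k ℕ.^ j)             ≈⟨ x^k≈x⇒x^k^j≈x k x^k≈x j ⟩
    x                         ∎

  x-y≈0⇒x≈y : ∀ {x y} → x - y ≈ 0# → x ≈ y
  x-y≈0⇒x≈y {x} {y} x-y≈0 = begin
    x             ≈⟨ solve 2 (λ x y → x := (x :- y) :+ y) refl x y ⟩
    (x - y) + y   ≈⟨ +-congʳ x-y≈0 ⟩
    0# + y        ≈⟨ +-identityˡ y ⟩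
    y             ∎

  inv : ∀ {x} → x ≉ 0# → Carrier
  inv {x} x≉0 = proj₁ (inverse x x≉0)

  *-inverseʳ : ∀ {x} (x≉0 : x ≉ 0#) → x * inv x≉0 ≈ 1#
  *-inverseʳ {x} x≉0 = proj₂ (inverse x x≉0)

  *-cancelˡ : ∀ {x y z} → x ≉ 0# → x * y ≈ x * z → y ≈ z
  *-cancelˡ {x} {y} {z} x≉0 xy≈xz = begin
    y                   ≈⟨ *-identityˡ y ⟨
    1# * y              ≈⟨ *-congʳ (trans (*-comm _ _) (*-inverseʳ x≉0)) ⟨
    (inv x≉0 * x) * y   ≈⟨ *-assoc _ _ _ ⟩
    inv x≉0 * (x * y)   ≈⟨ *-congˡ xy≈xz ⟩
    inv x≉0 * (x * z)   ≈⟨ *-assoc _ _ _ ⟨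
    (inv x≉0 * x) * z   ≈⟨ *-congʳ (trans (*-comm _ _) (*-inverseʳ x≉0)) ⟩
    1# * z              ≈⟨ *-identityˡ z ⟩
    z                   ∎

  *-≉0 : ∀ {x y} → x ≉ 0# → y ≉ 0# → x * y ≉ 0#
  *-≉0 x≉0 y≉0 xy≈0 = y≉0 (*-cancelˡ x≉0 (trans xy≈0 (sym (zeroʳ _))))

  x*y≈0⇒x≈0∨y≈0 : ∀ {x y} → x * y ≈ 0# → x ≈ 0# ⊎ y ≈ 0#
  x*y≈0⇒x≈0∨y≈0 {x} {y} xy≈0 with x ≟ 0# | y ≟ 0#
  ... | yes x≈0 | _ = inj₁ x≈0
  ... | no _ | yes y≈0 = inj₂ y≈0
  ... | no x≉0 | no y≉0 = ⊥-elim (*-≉0 x≉0 y≉0 xy≈0)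

  private
    product : List Carrier → Carrier
    product = foldr _*_ 1#

    product-─ : ∀ {x xs} (x∈xs : x ∈ xs) → product xs ≈ x * product (xs ─ x∈xs)
    product-─ (here x≈y) = *-congʳ (sym x≈y)
    product-─ {x} {y ∷ xs} (there x∈xs) = begin
      y * product xs                    ≈⟨ *-congˡ (product-─ x∈xs) ⟩
      y * (x * product (xs ─ x∈xs))     ≈⟨ solve 3 (λ y x p → y :* (x :* p) := x :* (y :* p))
                                                refl y x (product (xs ─ x∈xs)) ⟩
      x * (y * product (xs ─ x∈xs))     ∎

    product-⊆ : ∀ {xs ys} → Unique xs → xs ⊆ ys → length xs ≡ length ys → product xs ≈ product ys
    product-⊆ {[]} {[]} _ _ _ = refl
    product-⊆ {x ∷ xs} {ys} x∷xs!@(_ ∷ xs!) x∷xs⊆ys |x∷xs|≡|ys| = begin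
      x * product xs                ≈⟨ *-congˡ (product-⊆ xs! (∷⊆⇒⊆─ x∷xs! x∷xs⊆ys) |xs|≡|ys─x|) ⟩
      x * product (ys ─ x∈ys)       ≈⟨ product-─ x∈ys ⟨
      product ys                    ∎
      where
      x∈ys = x∷xs⊆ys (here refl)
      |xs|≡|ys─x| : length xs ≡ length (ys ─ x∈ys)
      |xs|≡|ys─x| = ℕ.suc-injective (≡.trans |x∷xs|≡|ys| (≡.sym (length-─ x∈ys)))

    product-map-x* : ∀ x xs → product (map (x *_) xs) ≈ x ^ length xs * product xs
    product-map-x* x [] = sym (*-identityˡ _)
    product-map-x* x (y ∷ xs) = begin
      (x * y) * product (map (x *_) xs)           ≈⟨ *-congˡ (product-map-x* x xs) ⟩
      (x * y) * (x ^ length xs * product xs)      ≈⟨ solve 4 (λ x y a b → (x :* y) :* (a :* b) := (x :* a) :* (y :* b))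
                                                          refl x y (x ^ length xs) (product xs) ⟩
      (x * x ^ length xs) * (y * product xs)      ∎

    product-≉0 : ∀ {xs} → All (_≉ 0#) xs → product xs ≉ 0#
    product-≉0 [] = 1≉0
    product-≉0 (x≉0 ∷ xs≉0) = *-≉0 x≉0 (product-≉0 xs≉0)

  x^q≈x : ∀ x → x ^ q ≈ x
  x^q≈x x with x ≟ 0#
  ... | yes x≈0 = begin
    x ^ q                 ≈⟨ ^-cong q x≈0 ⟩
    0# ^ q                ≡⟨ ≡.cong (0# ^_) (ℕ.suc-pred q {{ℕ.>-nonZero (ℕ.<-trans (s≤s z≤n) 2≤q)}}) ⟨
    0# ^ suc (ℕ.pred q)   ≈⟨ 0^[1+n]≈0 (ℕ.pred q) ⟩
    0#                    ≈⟨ x≈0 ⟨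
    x                     ∎
  ... | no x≉0 = begin
    x ^ q                 ≡⟨ ≡.cong (x ^_) (≡.trans (≡.sym length-elements) (≡.sym (length-─ 0∈))) ⟩
    x * x ^ length units  ≈⟨ *-congˡ x^|units|≈1 ⟩
    x * 1#                ≈⟨ *-identityʳ x ⟩
    x                     ∎
    where
    0∈ = ∈-elements 0#
    units = elements ─ 0∈
    units≉0 : All (_≉ 0#) units
    units≉0 = All.tabulateₛ setoid (∈-─⇒≉ 0∈ elements-Unique)
    x*units⊆units : map (x *_) units ⊆ units
    x*units⊆units y∈ with ∈.∈-map⁻ setoid setoid y∈
    ... | u , u∈ , y≈xu = ∈-─⁺ 0∈ (∈-elements _) λ y≈0 →
      *-≉0 x≉0 (∈-─⇒≉ 0∈ elements-Unique u∈) (trans (sym y≈xu) y≈0)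
    x^|units|≈1 : x ^ length units ≈ 1#
    x^|units|≈1 = *-cancelˡ (product-≉0 units≉0) (begin
      product units * x ^ length units    ≈⟨ *-comm _ _ ⟩
      x ^ length units * product units    ≈⟨ product-map-x* x units ⟨
      product (map (x *_) units)          ≈⟨ product-⊆ (Unique.map⁺ setoid setoid (*-cancelˡ x≉0) (─-Unique 0∈ elements-Unique))
                                                       x*units⊆units (List.length-map (x *_) units) ⟩
      product units                       ≈⟨ *-identityʳ _ ⟨
      product units * 1#                  ∎)

module PolynomialFunctions (F : FiniteField) where

  open import Data.Nat as ℕ using (zero; suc; _<_; z≤n; s≤s)
  import Data.Nat.Properties as ℕ
  open import Data.List using (List; []; _∷_; length; map)
  import Data.List.Properties as List
  open import Data.List.Relation.Unary.All using (All; []; _∷_)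
  open import Data.List.Relation.Unary.AllPairs using (_∷_)
  open import Data.Sum using (inj₁; inj₂)
  open import Data.Empty using (⊥-elim)
  open import Data.Integer using (+_)

  open FiniteField F hiding (size)
  open FiniteFieldProperties F
  open import Relation.Binary.Reasoning.Setoid setoid

  eval : List Carrier → Carrier → Carrier
  eval [] x = 0#
  eval (c ∷ cs) x = c + x * eval cs x

  record Degree< (d : ℕ) (h : Carrier → Carrier) : Set where
    constructor poly
    field
      coefficients : List Carrier
      length≤d     : length coefficients ℕ.≤ d
      ≈eval        : ∀ x → h x ≈ eval coefficients x

  record Monic (d : ℕ) (h : Carrier → Carrier) : Set where
    constructor monic
    field
      {lower}       : Carrier → Carrier
      lower-degree< : Degree< d lower
      ≈x^d+lower    : ∀ x → h x ≈ x ^ d + lower x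

  Degree<-cong : ∀ {d g h} → (∀ x → g x ≈ h x) → Degree< d g → Degree< d h
  Degree<-cong g≈h (poly cs |cs|≤d g≈) = poly cs |cs|≤d λ x → trans (sym (g≈h x)) (g≈ x)

  Degree<-mono : ∀ {d d′ h} → d ℕ.≤ d′ → Degree< d h → Degree< d′ h
  Degree<-mono d≤d′ (poly cs |cs|≤d h≈) = poly cs (ℕ.≤-trans |cs|≤d d≤d′) h≈

  Degree<-0 : ∀ {d} → Degree< d (λ _ → 0#)
  Degree<-0 = poly [] z≤n λ _ → refl

  Degree<-const : ∀ {d} c → Degree< (suc d) (λ _ → c)
  Degree<-const c = poly (c ∷ []) (s≤s z≤n) λ x → sym (trans (+-congˡ (zeroʳ x)) (+-identityʳ c))

  private
    add : List Carrier → List Carrier → List Carrier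
    add [] cs = cs
    add (b ∷ bs) [] = b ∷ bs
    add (b ∷ bs) (c ∷ cs) = (b + c) ∷ add bs cs

    length-add : ∀ {d} bs cs → length bs ℕ.≤ d → length cs ℕ.≤ d → length (add bs cs) ℕ.≤ d
    length-add [] cs _ |cs|≤d = |cs|≤d
    length-add (b ∷ bs) [] |bs|≤d _ = |bs|≤d
    length-add (b ∷ bs) (c ∷ cs) (s≤s |bs|≤d) (s≤s |cs|≤d) = s≤s (length-add bs cs |bs|≤d |cs|≤d)

    eval-add : ∀ bs cs x → eval (add bs cs) x ≈ eval bs x + eval cs x
    eval-add [] cs x = sym (+-identityˡ _)
    eval-add (b ∷ bs) [] x = sym (+-identityʳ _)
    eval-add (b ∷ bs) (c ∷ cs) x = begin
      (b + c) + x * eval (add bs cs) x          ≈⟨ +-congˡ (*-congˡ (eval-add bs cs x)) ⟩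
      (b + c) + x * (eval bs x + eval cs x)     ≈⟨ solve 5 (λ b c x u v → (b :+ c) :+ x :* (u :+ v) := (b :+ x :* u) :+ (c :+ x :* v))
                                                        refl b c x (eval bs x) (eval cs x) ⟩
      (b + x * eval bs x) + (c + x * eval cs x) ∎

    eval-scale : ∀ a cs x → eval (map (a *_) cs) x ≈ a * eval cs x
    eval-scale a [] x = sym (zeroʳ a)
    eval-scale a (c ∷ cs) x = begin
      a * c + x * eval (map (a *_) cs) x        ≈⟨ +-congˡ (*-congˡ (eval-scale a cs x)) ⟩
      a * c + x * (a * eval cs x)               ≈⟨ solve 4 (λ a c x u → a :* c :+ x :* (a :* u) := a :* (c :+ x :* u))
                                                        refl a c x (eval cs x) ⟩
      a * (c + x * eval cs x)                   ∎

  Degree<-+ : ∀ {d g h} → Degree< d g → Degree< d h → Degree< d (λ x → g x + h x)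
  Degree<-+ (poly bs |bs|≤d g≈) (poly cs |cs|≤d h≈) =
    poly (add bs cs) (length-add bs cs |bs|≤d |cs|≤d) λ x → trans (+-cong (g≈ x) (h≈ x)) (sym (eval-add bs cs x))

  Degree<-*ˡ : ∀ {d h} a → Degree< d h → Degree< d (λ x → a * h x)
  Degree<-*ˡ a (poly cs |cs|≤d h≈) =
    poly (map (a *_) cs) (ℕ.≤-trans (ℕ.≤-reflexive (List.length-map (a *_) cs)) |cs|≤d)
         λ x → trans (*-congˡ (h≈ x)) (sym (eval-scale a cs x))

  Degree<-neg : ∀ {d h} → Degree< d h → Degree< d (λ x → - h x)
  Degree<-neg {d} {h} h< = Degree<-cong (λ x → trans (sym (-‿distribˡ-* 1# (h x))) (-‿cong (*-identityˡ (h x)))) (Degree<-*ˡ (- 1#) h<)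
    where open import Algebra.Properties.Ring ring using (-‿distribˡ-*)

  Degree<-x* : ∀ {d h} → Degree< d h → Degree< (suc d) (λ x → x * h x)
  Degree<-x* (poly cs |cs|≤d h≈) = poly (0# ∷ cs) (s≤s |cs|≤d) λ x → trans (*-congˡ (h≈ x)) (sym (+-identityˡ _))

  Degree<-^ : ∀ {d} k → k < d → Degree< d (_^ k)
  Degree<-^ {suc d} zero _ = Degree<-const 1#
  Degree<-^ {suc d} (suc k) (s≤s k<d) = Degree<-x* (Degree<-^ k k<d)

  Degree<-sumTo : ∀ {d} n (h : ℕ → Carrier → Carrier) → (∀ i → i < n → Degree< d (h i)) →
                  Degree< d (λ x → sumTo n (λ i → h i x))
  Degree<-sumTo zero h h< = Degree<-0
  Degree<-sumTo (suc n) h h< = Degree<-+ (Degree<-sumTo n h (λ i i<n → h< i (ℕ.m≤n⇒m≤1+n i<n))) (h< n ℕ.≤-refl)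

  Monic-+ : ∀ {d g h} → Monic d g → Degree< d h → Monic d (λ x → g x + h x)
  Monic-+ (monic g< g≈) h< = monic (Degree<-+ g< h<) λ x → trans (+-congʳ (g≈ x)) (+-assoc _ _ _)

  x^d-x-Monic : ∀ {d} → 2 ℕ.≤ d → Monic d (λ x → x ^ d - x)
  x^d-x-Monic 2≤d = monic (Degree<-neg (Degree<-cong *-identityʳ (Degree<-^ 1 2≤d))) λ _ → refl

  private
    x^[1+d]-a^[1+d]-factor : ∀ d a → Σ (Carrier → Carrier) λ g → Monic d g × (∀ x → x ^ suc d - a ^ suc d ≈ (x - a) * g x)
    x^[1+d]-a^[1+d]-factor zero a = (λ _ → 1#) , monic Degree<-0 (λ _ → sym (+-identityʳ _)) , λ x →
      solve 3 (λ x a o → x :* o :- a :* o := (x :- a) :* o) refl x a 1#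
    x^[1+d]-a^[1+d]-factor (suc d) a with x^[1+d]-a^[1+d]-factor d a
    ... | g , monic {lower} lower< g≈ , factor = (λ x → x * g x + a ^ suc d) , g′-monic , factor′
      where
      g′-monic : Monic (suc d) (λ x → x * g x + a ^ suc d)
      g′-monic = monic (Degree<-+ (Degree<-x* lower<) (Degree<-const _)) λ x →
        trans (+-congʳ (*-congˡ (g≈ x)))
              (solve 4 (λ x X l c → x :* (X :+ l) :+ c := x :* X :+ (x :* l :+ c)) refl x (x ^ d) (lower x) (a ^ suc d))
      factor′ : ∀ x → x ^ suc (suc d) - a ^ suc (suc d) ≈ (x - a) * (x * g x + a ^ suc d)
      factor′ x = begin
        x * x ^ suc d - a * a ^ suc d                    ≈⟨ solve 4 (λ x a X A → x :* X :- a :* A := x :* (X :- A) :+ (x :- a) :* A)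
                                                                    refl x a (x ^ suc d) (a ^ suc d) ⟩
        x * (x ^ suc d - a ^ suc d) + (x - a) * a ^ suc d ≈⟨ +-congʳ (*-congˡ (factor x)) ⟩
        x * ((x - a) * g x) + (x - a) * a ^ suc d         ≈⟨ solve 4 (λ x a G A → x :* ((x :- a) :* G) :+ (x :- a) :* A := (x :- a) :* (x :* G :+ A))
                                                                    refl x a (g x) (a ^ suc d) ⟩
        (x - a) * (x * g x + a ^ suc d)                   ∎

    eval-factor : ∀ d a cs → length cs ℕ.≤ suc d →
      Σ (Carrier → Carrier) λ g → Degree< d g × (∀ x → eval cs x - eval cs a ≈ (x - a) * g x)
    eval-factor d a [] _ = (λ _ → 0#) , Degree<-0 , λ x → solve 2 (λ x a → con (+ 0) :- con (+ 0) := (x :- a) :* con (+ 0)) refl x a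
    eval-factor zero a (c ∷ []) _ = (λ _ → 0#) , Degree<-0 , λ x →
      solve 3 (λ c x a → (c :+ x :* con (+ 0)) :- (c :+ a :* con (+ 0)) := (x :- a) :* con (+ 0)) refl c x a
    eval-factor zero a (_ ∷ _ ∷ _) (s≤s ())
    eval-factor (suc d) a (c ∷ cs) (s≤s |cs|≤) with eval-factor d a cs |cs|≤
    ... | g , g< , factor = (λ x → eval cs x + a * g x) ,
      Degree<-+ (poly cs |cs|≤ λ _ → refl) (Degree<-*ˡ a (Degree<-mono (ℕ.n≤1+n d) g<)) , λ x → begin
        (c + x * eval cs x) - (c + a * eval cs a)        ≈⟨ solve 5 (λ c x a u v → (c :+ x :* u) :- (c :+ a :* v) := (x :- a) :* u :+ a :* (u :- v))
                                                                  refl c x a (eval cs x) (eval cs a) ⟩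
        (x - a) * eval cs x + a * (eval cs x - eval cs a) ≈⟨ +-congˡ (*-congˡ (factor x)) ⟩
        (x - a) * eval cs x + a * ((x - a) * g x)         ≈⟨ solve 4 (λ x a u g → (x :- a) :* u :+ a :* ((x :- a) :* g) := (x :- a) :* (u :+ a :* g))
                                                                  refl x a (eval cs x) (g x) ⟩
        (x - a) * (eval cs x + a * g x)                   ∎

  Monic-root-factor : ∀ {d h a} → Monic (suc d) h → h a ≈ 0# →
    Σ (Carrier → Carrier) λ g → Monic d g × (∀ x → h x ≈ (x - a) * g x)
  Monic-root-factor {d} {h} {a} (monic {l} (poly cs |cs|≤ l≈) h≈) ha≈0
    with x^[1+d]-a^[1+d]-factor d a | eval-factor d a cs |cs|≤
  ... | g₁ , g₁-monic , factor₁ | g₂ , g₂< , factor₂ = (λ x → g₁ x + g₂ x) , Monic-+ g₁-monic g₂< , λ x → begin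
    h x                                      ≈⟨ solve 2 (λ u v → u := u :- v :+ v) refl (h x) (h a) ⟩
    h x - h a + h a                          ≈⟨ +-congˡ ha≈0 ⟩
    h x - h a + 0#                           ≈⟨ +-identityʳ _ ⟩
    h x - h a                                ≈⟨ +-cong (h≈ x) (-‿cong (h≈ a)) ⟩
    (x ^ suc d + l x) - (a ^ suc d + l a)    ≈⟨ solve 4 (λ X A u v → (X :+ u) :- (A :+ v) := (X :- A) :+ (u :- v))
                                                       refl (x ^ suc d) (a ^ suc d) (l x) (l a) ⟩
    (x ^ suc d - a ^ suc d) + (l x - l a)    ≈⟨ +-cong (factor₁ x) (trans (+-cong (l≈ x) (-‿cong (l≈ a))) (factor₂ x)) ⟩
    (x - a) * g₁ x + (x - a) * g₂ x          ≈⟨ distribˡ _ _ _ ⟨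
    (x - a) * (g₁ x + g₂ x)                  ∎

  Monic⇒length-roots≤ : ∀ {d h} → Monic d h → ∀ {xs} → Unique xs → All (λ x → h x ≈ 0#) xs → length xs ℕ.≤ d
  Monic⇒length-roots≤ _ {[]} _ _ = z≤n
  Monic⇒length-roots≤ {zero} {h} (monic (poly [] _ l≈) h≈) {a ∷ _} _ (ha≈0 ∷ _) = ⊥-elim (1≉0 (begin
    1#           ≈⟨ +-identityʳ 1# ⟨
    1# + 0#      ≈⟨ +-congˡ (l≈ a) ⟨
    a ^ 0 + _    ≈⟨ h≈ a ⟨
    h a          ≈⟨ ha≈0 ⟩
    0#           ∎))
  Monic⇒length-roots≤ {suc d} {h} h-monic {a ∷ xs} (a≉ ∷ xs!) (ha≈0 ∷ hxs≈0)
    with Monic-root-factor h-monic ha≈0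
  ... | g , g-monic , factor = s≤s (Monic⇒length-roots≤ g-monic xs! (roots a≉ hxs≈0))
    where
    roots : ∀ {ys} → All (a ≉_) ys → All (λ x → h x ≈ 0#) ys → All (λ x → g x ≈ 0#) ys
    roots [] [] = []
    roots (a≉y ∷ a≉ys) (hy≈0 ∷ hys≈0) with x*y≈0⇒x≈0∨y≈0 (trans (sym (factor _)) hy≈0)
    ... | inj₁ y-a≈0 = ⊥-elim (a≉y (sym (x-y≈0⇒x≈y y-a≈0)))
    ... | inj₂ gy≈0 = gy≈0 ∷ roots a≉ys hys≈0

module Characteristic (F : FiniteField) where

  open import Data.Nat as ℕ using (zero; suc; _<_; _∸_; z≤n; s≤s)
  import Data.Nat.Properties as ℕ
  open import Data.Nat.Divisibility using (_∣_; divides; ∣-refl)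
  open import Data.Nat.Divisibility.Core using (hasNonTrivialDivisor)
  open import Data.Nat.Primality using (Composite; prime; ¬prime[0]; ¬prime[1])
  open import Data.Nat.Combinatorics using (_C_; nCn≡1)
  open import Data.Fin as Fin using (Fin; toℕ; fromℕ; inject₁)
  import Data.Fin.Properties as Fin
  open import Data.List using (applyUpTo)
  import Data.List.Properties as List
  import Data.List.Relation.Unary.Unique.Setoid.Properties as Unique
  open import Data.Sum using (inj₁; inj₂)
  open import Data.Empty using (⊥-elim)
  open import Relation.Nullary using (¬_)
  open import Relation.Binary.PropositionalEquality as ≡ using (_≡_; _≢_)

  open FiniteField F hiding (size)
  open FiniteFieldProperties F
  open NatFacts
  open import Algebra.Properties.Semiring.Mult semiring using (×-homo-+; ×1-homo-*; ×-assoc-*; ×-congʳ)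
    renaming (_×_ to _·_)
  open import Relation.Binary.Reasoning.Setoid setoid

  Additive : ℕ → Set
  Additive k = ∀ x y → (x + y) ^ k ≈ x ^ k + y ^ k

  Additive-1 : Additive 1
  Additive-1 x y = distribʳ 1# x y

  Additive-* : ∀ {a b} → Additive a → Additive b → Additive (a ℕ.* b)
  Additive-* {a} {b} a-additive b-additive x y = begin
    (x + y) ^ (a ℕ.* b)           ≈⟨ ^-*-assoc (x + y) a b ⟨
    ((x + y) ^ a) ^ b             ≈⟨ ^-cong b (a-additive x y) ⟩
    (x ^ a + y ^ a) ^ b           ≈⟨ b-additive _ _ ⟩
    (x ^ a) ^ b + (y ^ a) ^ b     ≈⟨ +-cong (^-*-assoc x a b) (^-*-assoc y a b) ⟩
    x ^ (a ℕ.* b) + y ^ (a ℕ.* b) ∎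

  Additive-^ : ∀ {a} → Additive a → ∀ e → Additive (a ℕ.^ e)
  Additive-^ _ zero = Additive-1
  Additive-^ {a} a-additive (suc e) = Additive-* {a} {a ℕ.^ e} a-additive (Additive-^ a-additive e)

  0^k≈0 : ∀ {k} → 0 < k → 0# ^ k ≈ 0#
  0^k≈0 {suc k} _ = 0^[1+n]≈0 k

  Additive⇒-^ : ∀ {k} → Additive k → 0 < k → ∀ x → (- x) ^ k ≈ - (x ^ k)
  Additive⇒-^ {k} k-additive 0<k x = begin
    (- x) ^ k                     ≈⟨ solve 2 (λ a b → a := (b :+ a) :- b) refl ((- x) ^ k) (x ^ k) ⟩
    (x ^ k + (- x) ^ k) - x ^ k   ≈⟨ +-congʳ (k-additive x (- x)) ⟨
    (x - x) ^ k - x ^ k           ≈⟨ +-congʳ (trans (^-cong k (-‿inverseʳ x)) (0^k≈0 0<k)) ⟩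
    0# - x ^ k                    ≈⟨ +-identityˡ _ ⟩
    - (x ^ k)                     ∎

  Additive⇒sumTo-^ : ∀ {k} → Additive k → 0 < k → ∀ n f → sumTo n f ^ k ≈ sumTo n (λ i → f i ^ k)
  Additive⇒sumTo-^ _ 0<k zero f = 0^k≈0 0<k
  Additive⇒sumTo-^ k-additive 0<k (suc n) f =
    trans (k-additive _ _) (+-congʳ (Additive⇒sumTo-^ k-additive 0<k n f))

  n·x≈[n·1]*x : ∀ n x → n · x ≈ (n · 1#) * x
  n·x≈[n·1]*x n x = sym (trans (×-assoc-* n 1# x) (×-congʳ n (*-identityˡ x)))

  CharacteristicIs : ℕ → Set
  CharacteristicIs p = Prime p × p · 1# ≈ 0#

  private
    m·1≈[m+k]·1⇒k·1≈0 : ∀ m k → m · 1# ≈ (m ℕ.+ k) · 1# → k · 1# ≈ 0#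
    m·1≈[m+k]·1⇒k·1≈0 m k m≈m+k = begin
      k · 1#                          ≈⟨ solve 2 (λ a b → b := (a :+ b) :- a) refl (m · 1#) (k · 1#) ⟩
      (m · 1# + k · 1#) - m · 1#      ≈⟨ +-congʳ (×-homo-+ 1# m k) ⟨
      (m ℕ.+ k) · 1# - m · 1#         ≈⟨ +-congʳ m≈m+k ⟨
      m · 1# - m · 1#                 ≈⟨ -‿inverseʳ _ ⟩
      0#                              ∎

  multiple-of-characteristic·x≈0 : ∀ {p k} → CharacteristicIs p → p ∣ k → ∀ x → k · x ≈ 0#
  multiple-of-characteristic·x≈0 {p} {k} (_ , p·1≈0) (divides c k≡c*p) x = begin
    k · x                     ≈⟨ n·x≈[n·1]*x k x ⟩
    (k · 1#) * x              ≈⟨ *-congʳ (trans (reflexive (≡.cong (_· 1#) k≡c*p)) (×1-homo-* c p)) ⟩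
    ((c · 1#) * (p · 1#)) * x ≈⟨ *-congʳ (trans (*-congˡ p·1≈0) (zeroʳ _)) ⟩
    0# * x                    ≈⟨ zeroˡ x ⟩
    0#                        ∎

  characteristic : ∃ CharacteristicIs
  characteristic with least? (λ k → suc k · 1# ≟ 0#) q
  ... | inj₁ none = ⊥-elim (ℕ.<-irrefl ≡.refl (ℕ.≤-trans
      (ℕ.≤-reflexive (≡.sym (List.length-applyUpTo (_· 1#) (suc q))))
      (Unique⇒length≤q (Unique.applyUpTo⁺₁ setoid (_· 1#) (suc q) distinct))))
    where
    distinct : ∀ {i j} → i < j → j < suc q → i · 1# ≉ j · 1#
    distinct {i} {j} i<j j≤q i≈j with ℕ.m≤n⇒∃[o]m+o≡n (ℕ.<⇒≤ i<j)
    ... | zero , i+0≡j = ℕ.<-irrefl (≡.trans (≡.sym (ℕ.+-identityʳ i)) i+0≡j) i<j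
    ... | suc d , i+1+d≡j = none d (ℕ.≤-trans (ℕ.m≤n+m (suc d) i) (ℕ.≤-trans (ℕ.≤-reflexive i+1+d≡j) (ℕ.≤-pred j≤q)))
            (m·1≈[m+k]·1⇒k·1≈0 i (suc d) (trans i≈j (reflexive (≡.cong (_· 1#) (≡.sym i+1+d≡j)))))
  ... | inj₂ (zero , _ , 1≈0 , _) = ⊥-elim (1≉0 (trans (sym (+-identityʳ 1#)) 1≈0))
  ... | inj₂ (suc k , _ , p·1≈0 , minimal) = suc (suc k) , prime ¬composite , p·1≈0
    where
    p = suc (suc k)
    ·1≉0 : ∀ {a} → 0 < a → a < p → a · 1# ≉ 0#
    ·1≉0 {suc a} _ (s≤s a<1+k) = minimal a a<1+k
    ¬composite : ¬ Composite p
    ¬composite (hasNonTrivialDivisor {d} d<p (divides c p≡c*d))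
      with x*y≈0⇒x≈0∨y≈0 (trans (sym (×1-homo-* c d)) (trans (reflexive (≡.cong (_· 1#) (≡.sym p≡c*d))) p·1≈0))
    ... | inj₂ d·1≈0 = ·1≉0 (ℕ.<-trans (s≤s z≤n) (ℕ.nonTrivial⇒n>1 d)) d<p d·1≈0
    ... | inj₁ c·1≈0 = ·1≉0 (ℕ.n≢0⇒n>0 c≢0) c<p c·1≈0
      where
      c≢0 : c ≢ 0
      c≢0 ≡.refl = ℕ.<-irrefl ≡.refl (ℕ.<-≤-trans (s≤s z≤n) (ℕ.≤-reflexive p≡c*d))
      c<p : c < p
      c<p = ℕ.<-≤-trans (ℕ.m<m*n c d {{ℕ.≢-nonZero c≢0}} (ℕ.nonTrivial⇒n>1 d)) (ℕ.≤-reflexive (≡.sym p≡c*d))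

  frobenius-Additive : ∀ {p} → CharacteristicIs p → Additive p
  frobenius-Additive {0} (pp , _) = ⊥-elim (¬prime[0] pp)
  frobenius-Additive {1} (pp , _) = ⊥-elim (¬prime[1] pp)
  frobenius-Additive {suc (suc r)} char@(pp , _) x y = begin
    (x + y) ^ p                                       ≈⟨ ^ₛ≈^ (x + y) p ⟨
    (x + y) ^ₛ p                                      ≈⟨ Binomial.theorem p x y ⟩
    sum term                                          ≈⟨ +-congˡ (sum-init-last (λ k → term (Fin.suc k))) ⟩
    term Fin.zero + (sum (λ k → term (Fin.suc (inject₁ k))) + term (fromℕ p))
                                                      ≈⟨ +-congˡ (+-congʳ (sum-0 (suc r) middle≈0)) ⟩
    term Fin.zero + (0# + term (fromℕ p))             ≈⟨ +-cong first (trans (+-identityˡ _) last) ⟩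
    y ^ p + x ^ p                                     ≈⟨ +-comm _ _ ⟩
    x ^ p + y ^ p                                     ∎
    where
    p = suc (suc r)
    open import Algebra.Properties.Semiring.Exp semiring using () renaming (_^_ to _^ₛ_)
    import Algebra.Properties.CommutativeSemiring.Binomial commutativeSemiring as Binomial
    open import Algebra.Properties.Semiring.Sum semiring using (sum; sum-init-last)
    term = Binomial.binomialTerm x y p
    ^ₛ≈^ : ∀ z n → z ^ₛ n ≈ z ^ n
    ^ₛ≈^ z zero = refl
    ^ₛ≈^ z (suc n) = *-congˡ (^ₛ≈^ z n)
    sum-0 : ∀ n {t : Fin n → Carrier} → (∀ k → t k ≈ 0#) → sum t ≈ 0#
    sum-0 zero _ = refl
    sum-0 (suc n) t≈0 = trans (+-cong (t≈0 Fin.zero) (sum-0 n (λ k → t≈0 (Fin.suc k)))) (+-identityʳ 0#)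
    middle≈0 : ∀ (k : Fin (suc r)) → term (Fin.suc (inject₁ k)) ≈ 0#
    middle≈0 k = multiple-of-characteristic·x≈0 char
      (p∣pCk pp (s≤s z≤n) (s≤s (ℕ.≤-trans (ℕ.≤-reflexive (≡.cong suc (Fin.toℕ-inject₁ k))) (Fin.toℕ<n k)))) _
    first : term Fin.zero ≈ y ^ p
    first = trans (+-identityʳ _) (trans (*-identityˡ _) (^ₛ≈^ y p))
    last : term (fromℕ p) ≈ x ^ p
    last = begin
      (p C toℕ (fromℕ p)) · (x ^ₛ toℕ (fromℕ p) * y ^ₛ (p ∸ toℕ (fromℕ p)))
        ≡⟨ ≡.cong (λ j → (p C j) · (x ^ₛ j * y ^ₛ (p ∸ j))) (Fin.toℕ-fromℕ p) ⟩
      (p C p) · (x ^ₛ p * y ^ₛ (p ∸ p))     ≡⟨ ≡.cong₂ (λ c j → c · (x ^ₛ p * y ^ₛ j)) (nCn≡1 p) (ℕ.n∸n≡0 p) ⟩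
      1 · (x ^ₛ p * 1#)                     ≈⟨ trans (+-identityʳ _) (*-identityʳ _) ⟩
      x ^ₛ p                                ≈⟨ ^ₛ≈^ x p ⟩
      x ^ p                                 ∎

  module _ {p : ℕ} (char : CharacteristicIs p) where

    open import Data.List using (List; []; _∷_; length; map; _++_)
    open import Data.List.Relation.Unary.Any using (here)
    open import Data.List.Relation.Unary.All using ([])
    open import Data.List.Relation.Unary.AllPairs using ([]; _∷_)
    import Data.List.Membership.Setoid.Properties as ∈
    open import Data.Nat.Coprimality using (prime⇒coprime; coprime-Bézout)
    open import Data.Nat.GCD using (module Bézout)
    open import Data.Nat.Primality using (prime⇒nonZero; prime⇒nonTrivial)
    open import Relation.Nullary using (yes; no)
    open import Algebra.Properties.Semiring.Mult semiring using (×-assocˡ)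

    private
      p-prime = proj₁ char

      instance
        p≢0 : ℕ.NonZero p
        p≢0 = prime⇒nonZero p-prime

      p·x≈0 : ∀ x → p · x ≈ 0#
      p·x≈0 = multiple-of-characteristic·x≈0 char ∣-refl

    record Subspace : Set where
      field
        vectors    : List Carrier
        unique     : Unique vectors
        dimension  : ℕ
        cardinality : length vectors ≡ p ℕ.^ dimension
        0∈         : 0# ∈ vectors
        +-closed   : ∀ {x y} → x ∈ vectors → y ∈ vectors → x + y ∈ vectors

      ·-closed : ∀ m {x} → x ∈ vectors → m · x ∈ vectors
      ·-closed zero _ = 0∈
      ·-closed (suc m) x∈ = +-closed x∈ (·-closed m x∈)

      -‿closed : ∀ {x} → x ∈ vectors → - x ∈ vectors
      -‿closed {x} x∈ = ∈-resp-≈ [p-1]·x≈-x (·-closed (ℕ.pred p) x∈)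
        where
        [p-1]·x≈-x : ℕ.pred p · x ≈ - x
        [p-1]·x≈-x = begin
          ℕ.pred p · x                 ≈⟨ solve 2 (λ a x → a := :- x :+ (x :+ a)) refl (ℕ.pred p · x) x ⟩
          - x + (x + ℕ.pred p · x)     ≡⟨ ≡.cong (λ n → - x + n · x) (ℕ.suc-pred p) ⟩
          - x + p · x                  ≈⟨ +-congˡ (p·x≈0 x) ⟩
          - x + 0#                     ≈⟨ +-identityʳ _ ⟩
          - x                          ∎

      -- By Bézout some multiple of a is ±1 modulo p.
      ·-cancel : ∀ a {v} → 0 < a → a < p → a · v ∈ vectors → v ∈ vectors
      ·-cancel a {v} 0<a a<p a·v∈ with coprime-Bézout (prime⇒coprime p-prime {{ℕ.>-nonZero 0<a}} a<p)
      ... | Bézout.-+ x y 1+x*p≡y*a = ∈-resp-≈ y·a·v≈v (·-closed y a·v∈)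
        where
        y·a·v≈v : y · (a · v) ≈ v
        y·a·v≈v = begin
          y · (a · v)              ≈⟨ ×-assocˡ v y a ⟩
          (y ℕ.* a) · v            ≡⟨ ≡.cong (_· v) 1+x*p≡y*a ⟨
          v + (x ℕ.* p) · v        ≈⟨ +-congˡ (×-assocˡ v x p) ⟨
          v + x · (p · v)          ≈⟨ +-congˡ (×-congʳ x (p·x≈0 v)) ⟩
          v + x · 0#               ≈⟨ +-congˡ (trans (n·x≈[n·1]*x x 0#) (zeroʳ _)) ⟩
          v + 0#                   ≈⟨ +-identityʳ v ⟩
          v                        ∎
      ... | Bézout.+- x y 1+y*a≡x*p = ∈-resp-≈ -y·a·v≈v (-‿closed (·-closed y a·v∈))
        where
        -y·a·v≈v : - (y · (a · v)) ≈ v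
        -y·a·v≈v = begin
          - (y · (a · v))                   ≈⟨ solve 2 (λ u v → :- u := v :- (v :+ u)) refl (y · (a · v)) v ⟩
          v - (v + y · (a · v))             ≈⟨ +-congˡ (-‿cong (+-congˡ (×-assocˡ v y a))) ⟩
          v - (v + (y ℕ.* a) · v)           ≡⟨ ≡.cong (λ n → v - n · v) 1+y*a≡x*p ⟩
          v - (x ℕ.* p) · v                 ≈⟨ +-congˡ (-‿cong (trans (sym (×-assocˡ v x p)) (×-congʳ x (p·x≈0 v)))) ⟩
          v - x · 0#                        ≈⟨ +-congˡ (-‿cong (trans (n·x≈[n·1]*x x 0#) (zeroʳ _))) ⟩
          v - 0#                            ≈⟨ solve 1 (λ v → v :- con (+ 0) := v) refl v ⟩
          v                                 ∎
          where open import Data.Integer using (+_)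

    module _ (V : Subspace) {v} (v∉V : v ∉ Subspace.vectors V) where

      open Subspace V

      private
        shift : ℕ → Carrier → Carrier
        shift c w = w + c · v

        layers : ℕ → List Carrier
        layers zero = []
        layers (suc c) = map (shift c) vectors ++ layers c

        length-layers : ∀ n → length (layers n) ≡ n ℕ.* length vectors
        length-layers zero = ≡.refl
        length-layers (suc n) = ≡.trans (List.length-++ (map (shift n) vectors))
                                        (≡.cong₂ ℕ._+_ (List.length-map (shift n) vectors) (length-layers n))

        ∈-layers⁻ : ∀ {y} n → y ∈ layers n → ∃ λ c → ∃ λ w → c < n × w ∈ vectors × y ≈ shift c w
        ∈-layers⁻ (suc n) y∈ with ∈.∈-++⁻ setoid (map (shift n) vectors) y∈
        ... | inj₁ y∈map with ∈.∈-map⁻ setoid setoid y∈map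
        ...   | w , w∈ , y≈ = n , w , ℕ.≤-refl , w∈ , y≈
        ∈-layers⁻ (suc n) y∈ | inj₂ y∈layers with ∈-layers⁻ n y∈layers
        ...   | c , w , c<n , w∈ , y≈ = c , w , ℕ.m≤n⇒m≤1+n c<n , w∈ , y≈

        ∈-layers⁺ : ∀ {w} c n → c < n → w ∈ vectors → shift c w ∈ layers n
        ∈-layers⁺ c (suc n) c<1+n w∈ with ℕ.m≤n⇒m<n∨m≡n (ℕ.≤-pred c<1+n)
        ... | inj₁ c<n = ∈.∈-++⁺ʳ setoid (map (shift n) vectors) (∈-layers⁺ c n c<n w∈)
        ... | inj₂ ≡.refl = ∈.∈-++⁺ˡ setoid (∈.∈-map⁺ setoid setoid +-congʳ w∈)

        -- otherwise (c - c′)·v ∈ V, and then v ∈ V by ·-cancel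
        shift-disjoint : ∀ {c c′ w w′} → c′ < c → c < p → w ∈ vectors → w′ ∈ vectors → shift c w ≉ shift c′ w′
        shift-disjoint {c} {c′} {w} {w′} c′<c c<p w∈ w′∈ c,w≈c′,w′ with ℕ.m≤n⇒∃[o]m+o≡n (ℕ.<⇒≤ c′<c)
        ... | zero , c′+0≡c = ℕ.<-irrefl (≡.trans (≡.sym (ℕ.+-identityʳ c′)) c′+0≡c) c′<c
        ... | suc d , c′+1+d≡c = v∉V (·-cancel (suc d) (s≤s z≤n) 1+d<p (∈-resp-≈ w′-w≈[1+d]·v (+-closed w′∈ (-‿closed w∈))))
          where
          1+d<p : suc d < p
          1+d<p = ℕ.≤-<-trans (ℕ.≤-trans (ℕ.m≤n+m (suc d) c′) (ℕ.≤-reflexive c′+1+d≡c)) c<p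
          w′-w≈[1+d]·v : w′ - w ≈ suc d · v
          w′-w≈[1+d]·v = begin
            w′ - w                                          ≈⟨ solve 4 (λ w w′ A v → w′ :- w := (w′ :+ A) :- (w :+ A)) refl w w′ (c′ · v) v ⟩
            (w′ + c′ · v) - (w + c′ · v)                    ≈⟨ +-congʳ c,w≈c′,w′ ⟨
            (w + c · v) - (w + c′ · v)                      ≡⟨ ≡.cong (λ n → (w + n · v) - (w + c′ · v)) c′+1+d≡c ⟨
            (w + (c′ ℕ.+ suc d) · v) - (w + c′ · v)         ≈⟨ +-congʳ (+-congˡ (×-homo-+ v c′ (suc d))) ⟩
            (w + (c′ · v + suc d · v)) - (w + c′ · v)       ≈⟨ solve 3 (λ w A B → (w :+ (A :+ B)) :- (w :+ A) := B) refl w (c′ · v) (suc d · v) ⟩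
            suc d · v                                       ∎

        layers-unique : ∀ n → n ℕ.≤ p → Unique (layers n)
        layers-unique zero _ = []
        layers-unique (suc n) n<p = Unique.++⁺ setoid
          (Unique.map⁺ setoid setoid shift-injective unique) (layers-unique n (ℕ.<⇒≤ n<p)) disjoint
          where
          import Data.List.Relation.Unary.Unique.Setoid.Properties as Unique
          shift-injective : ∀ {x y} → shift n x ≈ shift n y → x ≈ y
          shift-injective {x} {y} e = begin
            x                           ≈⟨ solve 2 (λ x a → x := (x :+ a) :- a) refl x (n · v) ⟩
            (x + n · v) - n · v         ≈⟨ +-congʳ e ⟩
            (y + n · v) - n · v         ≈⟨ solve 2 (λ x a → (x :+ a) :- a := x) refl y (n · v) ⟩
            y                           ∎
          disjoint : ∀ {y} → ¬ (y ∈ map (shift n) vectors × y ∈ layers n)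
          disjoint (y∈map , y∈layers) with ∈.∈-map⁻ setoid setoid y∈map | ∈-layers⁻ n y∈layers
          ... | w , w∈ , y≈ | c′ , w′ , c′<n , w′∈ , y≈′ = shift-disjoint c′<n n<p w∈ w′∈ (trans (sym y≈) y≈′)

        regroup : ∀ c₁ c₂ w₁ w₂ → shift c₁ w₁ + shift c₂ w₂ ≈ (w₁ + w₂) + (c₁ · v + c₂ · v)
        regroup c₁ c₂ w₁ w₂ = solve 4 (λ w₁ w₂ a b → (w₁ :+ a) :+ (w₂ :+ b) := (w₁ :+ w₂) :+ (a :+ b))
                                     refl w₁ w₂ (c₁ · v) (c₂ · v)

        layers-+-closed : ∀ {x y} → x ∈ layers p → y ∈ layers p → x + y ∈ layers p
        layers-+-closed {x} {y} x∈ y∈ with ∈-layers⁻ p x∈ | ∈-layers⁻ p y∈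
        ... | c₁ , w₁ , c₁<p , w₁∈ , x≈ | c₂ , w₂ , c₂<p , w₂∈ , y≈ with c₁ ℕ.+ c₂ ℕ.<? p
        ...   | yes c₁+c₂<p = ∈-resp-≈ (sym (begin
                  x + y                                  ≈⟨ +-cong x≈ y≈ ⟩
                  shift c₁ w₁ + shift c₂ w₂              ≈⟨ regroup c₁ c₂ w₁ w₂ ⟩
                  (w₁ + w₂) + (c₁ · v + c₂ · v)          ≈⟨ +-congˡ (×-homo-+ v c₁ c₂) ⟨
                  shift (c₁ ℕ.+ c₂) (w₁ + w₂)            ∎))
                (∈-layers⁺ (c₁ ℕ.+ c₂) p c₁+c₂<p (+-closed w₁∈ w₂∈))
        ...   | no c₁+c₂≮p with ℕ.m≤n⇒∃[o]m+o≡n (ℕ.≮⇒≥ c₁+c₂≮p)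
        ...     | c₃ , p+c₃≡c₁+c₂ = ∈-resp-≈ (sym (begin
                  x + y                                  ≈⟨ +-cong x≈ y≈ ⟩
                  shift c₁ w₁ + shift c₂ w₂              ≈⟨ regroup c₁ c₂ w₁ w₂ ⟩
                  (w₁ + w₂) + (c₁ · v + c₂ · v)          ≈⟨ +-congˡ (×-homo-+ v c₁ c₂) ⟨
                  (w₁ + w₂) + (c₁ ℕ.+ c₂) · v            ≡⟨ ≡.cong (λ n → (w₁ + w₂) + n · v) p+c₃≡c₁+c₂ ⟨
                  (w₁ + w₂) + (p ℕ.+ c₃) · v             ≈⟨ +-congˡ (×-homo-+ v p c₃) ⟩
                  (w₁ + w₂) + (p · v + c₃ · v)           ≈⟨ +-congˡ (trans (+-congʳ (p·x≈0 v)) (+-identityˡ _)) ⟩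
                  shift c₃ (w₁ + w₂)                     ∎))
                (∈-layers⁺ c₃ p c₃<p (+-closed w₁∈ w₂∈))
          where
          c₃<p : c₃ < p
          c₃<p = ℕ.+-cancelˡ-< p c₃ p (≡.subst (ℕ._< p ℕ.+ p) (≡.sym p+c₃≡c₁+c₂) (ℕ.+-mono-< c₁<p c₂<p))

      extend : Subspace
      extend = record
        { vectors = layers p
        ; unique = layers-unique p ℕ.≤-refl
        ; dimension = suc dimension
        ; cardinality = ≡.trans (length-layers p) (≡.cong (p ℕ.*_) cardinality)
        ; 0∈ = ∈-resp-≈ (+-identityʳ 0#) (∈-layers⁺ 0 p (ℕ.>-nonZero⁻¹ p) 0∈)
        ; +-closed = layers-+-closed
        }

      extend-grows : length vectors < length (Subspace.vectors extend)
      extend-grows = ℕ.<-≤-trans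
        (ℕ.m<m*n (length vectors) p {{ℕ.>-nonZero (∈.∈-length setoid 0∈)}} (ℕ.nonTrivial⇒n>1 p {{prime⇒nonTrivial p-prime}}))
        (ℕ.≤-reflexive (≡.trans (ℕ.*-comm (length vectors) p) (≡.sym (length-layers p))))

    q≡p^e : ∃ λ e → q ≡ p ℕ.^ e
    q≡p^e = grow (suc q) zeroSubspace (s≤s (ℕ.n≤1+n q))
      where
      open import Data.List.Relation.Unary.Any as Any using (any?; satisfied)
      open import Relation.Nullary using (¬?)
      zeroSubspace : Subspace
      zeroSubspace = record
        { vectors = 0# ∷ [] ; unique = [] ∷ [] ; dimension = 0 ; cardinality = ≡.refl ; 0∈ = here refl
        ; +-closed = λ { (here x≈0) (here y≈0) → here (trans (+-cong x≈0 y≈0) (+-identityˡ 0#)) } }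
      grow : ∀ fuel (V : Subspace) → q < length (Subspace.vectors V) ℕ.+ fuel → ∃ λ e → q ≡ p ℕ.^ e
      grow zero V q<|V|+0 = ⊥-elim (ℕ.<-irrefl ≡.refl
        (ℕ.<-≤-trans (ℕ.<-≤-trans q<|V|+0 (ℕ.≤-reflexive (ℕ.+-identityʳ _))) (Unique⇒length≤q (Subspace.unique V))))
      grow (suc fuel) V q<|V|+1+fuel with any? (λ x → ¬? (x ∈? Subspace.vectors V)) elements
      ... | yes some∉ with satisfied some∉
      ...   | x , x∉V = grow fuel (extend V x∉V) (ℕ.<-≤-trans q<|V|+1+fuel
                (ℕ.≤-trans (ℕ.≤-reflexive (ℕ.+-suc _ fuel)) (ℕ.+-monoˡ-≤ fuel (extend-grows V x∉V))))
      grow (suc fuel) V _ | no none∉ = Subspace.dimension V , ≡.trans (ℕ.≤-antisym q≤|V| (Unique⇒length≤q (Subspace.unique V))) (Subspace.cardinality V)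
        where
        elements⊆V : elements ⊆ Subspace.vectors V
        elements⊆V {y} _ with y ∈? Subspace.vectors V
        ... | yes y∈V = y∈V
        ... | no y∉V = ⊥-elim (none∉ (Any.map (λ y≈x → ∈.∉-resp-≈ setoid y≈x y∉V) (∈-elements y)))
        q≤|V| : q ℕ.≤ length (Subspace.vectors V)
        q≤|V| = ℕ.≤-trans (ℕ.≤-reflexive (≡.sym length-elements)) (Unique∧⊆⇒length≤ elements-Unique elements⊆V)

    q·1≈0 : q · 1# ≈ 0#
    q·1≈0 with q≡p^e
    ... | zero , q≡1 = ⊥-elim (ℕ.<-irrefl (≡.sym q≡1) 2≤q)
    ... | suc e , q≡p*p^e =
      multiple-of-characteristic·x≈0 char (divides (p ℕ.^ e) (≡.trans q≡p*p^e (ℕ.*-comm p (p ℕ.^ e)))) 1#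

module Sums (F : FiniteField) where

  open import Data.Nat as ℕ using (zero; suc; _<_)
  import Data.Nat.Properties as ℕ
  open import Relation.Binary.PropositionalEquality as ≡ using (_≡_)

  open FiniteField F hiding (size)
  open FiniteFieldProperties F using (solve; _:=_; _:+_; _:-_)
  open import Relation.Binary.Reasoning.Setoid setoid

  sumTo-cong : ∀ n {f g : ℕ → Carrier} → (∀ i → i < n → f i ≈ g i) → sumTo n f ≈ sumTo n g
  sumTo-cong zero _ = refl
  sumTo-cong (suc n) f≈g = +-cong (sumTo-cong n (λ i i<n → f≈g i (ℕ.m≤n⇒m≤1+n i<n))) (f≈g n ℕ.≤-refl)

  sumTo-0 : ∀ n → sumTo n (λ _ → 0#) ≈ 0#
  sumTo-0 zero = refl
  sumTo-0 (suc n) = trans (+-identityʳ _) (sumTo-0 n)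

  sumTo-+ : ∀ n (f g : ℕ → Carrier) → sumTo n (λ i → f i + g i) ≈ sumTo n f + sumTo n g
  sumTo-+ zero _ _ = sym (+-identityˡ 0#)
  sumTo-+ (suc n) f g = trans (+-congʳ (sumTo-+ n f g))
    (solve 4 (λ a b c d → (a :+ b) :+ (c :+ d) := (a :+ c) :+ (b :+ d)) refl (sumTo n f) (sumTo n g) (f n) (g n))

  *-distribˡ-sumTo : ∀ n c (f : ℕ → Carrier) → c * sumTo n f ≈ sumTo n (λ i → c * f i)
  *-distribˡ-sumTo zero c _ = zeroʳ c
  *-distribˡ-sumTo (suc n) c f = trans (distribˡ _ _ _) (+-congʳ (*-distribˡ-sumTo n c f))

  sumTo-suc : ∀ n (f : ℕ → Carrier) → sumTo (suc n) f ≈ f 0 + sumTo n (λ i → f (suc i))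
  sumTo-suc zero f = trans (+-identityˡ _) (sym (+-identityʳ _))
  sumTo-suc (suc n) f = trans (+-congʳ (sumTo-suc n f)) (+-assoc _ _ _)

  sumTo-rotate : ∀ n (f : ℕ → Carrier) → f n ≈ f 0 → sumTo n (λ i → f (suc i)) ≈ sumTo n f
  sumTo-rotate n f fn≈f0 = begin
    S′                              ≈⟨ solve 2 (λ S c → S := (c :+ S) :- c) refl S′ (f 0) ⟩
    (f 0 + S′) - f 0                ≈⟨ +-congʳ (sumTo-suc n f) ⟨
    (sumTo n f + f n) - f 0         ≈⟨ +-congʳ (+-congˡ fn≈f0) ⟩
    (sumTo n f + f 0) - f 0         ≈⟨ solve 2 (λ S c → (S :+ c) :- c := S) refl (sumTo n f) (f 0) ⟩
    sumTo n f                       ∎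
    where S′ = sumTo n (λ i → f (suc i))

  sumTo-+-index : ∀ a b (f : ℕ → Carrier) → sumTo (a ℕ.+ b) f ≈ sumTo a f + sumTo b (λ k → f (a ℕ.+ k))
  sumTo-+-index a zero f = trans (reflexive (≡.cong (λ k → sumTo k f) (ℕ.+-identityʳ a))) (sym (+-identityʳ _))
  sumTo-+-index a (suc b) f = begin
    sumTo (a ℕ.+ suc b) f                               ≡⟨ ≡.cong (λ k → sumTo k f) (ℕ.+-suc a b) ⟩
    sumTo (a ℕ.+ b) f + f (a ℕ.+ b)                     ≈⟨ +-congʳ (sumTo-+-index a b f) ⟩
    (sumTo a f + sumTo b (λ k → f (a ℕ.+ k))) + f (a ℕ.+ b) ≈⟨ +-assoc _ _ _ ⟩
    sumTo a f + sumTo (suc b) (λ k → f (a ℕ.+ k))       ∎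

  sumTo-*-index : ∀ r m (f : ℕ → Carrier) → sumTo (r ℕ.* m) f ≈ sumTo r (λ i → sumTo m (λ j → f (i ℕ.* m ℕ.+ j)))
  sumTo-*-index zero m f = refl
  sumTo-*-index (suc r) m f = begin
    sumTo (m ℕ.+ r ℕ.* m) f                                              ≈⟨ sumTo-+-index m (r ℕ.* m) f ⟩
    sumTo m f + sumTo (r ℕ.* m) (λ k → f (m ℕ.+ k))                      ≈⟨ +-congˡ (sumTo-*-index r m (λ k → f (m ℕ.+ k))) ⟩
    sumTo m f + sumTo r (λ i → sumTo m (λ j → f (m ℕ.+ (i ℕ.* m ℕ.+ j))))
      ≈⟨ +-congˡ (sumTo-cong r (λ i _ → sumTo-cong m (λ j _ → reflexive (≡.cong f (≡.sym (ℕ.+-assoc m (i ℕ.* m) j)))))) ⟩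
    sumTo m (λ j → f (0 ℕ.* m ℕ.+ j)) + sumTo r (λ i → sumTo m (λ j → f (suc i ℕ.* m ℕ.+ j))) ≈⟨ sumTo-suc r _ ⟨
    sumTo (suc r) (λ i → sumTo m (λ j → f (i ℕ.* m ℕ.+ j)))            ∎

  sumTo-comm : ∀ a b (f : ℕ → ℕ → Carrier) → sumTo a (λ i → sumTo b (λ j → f i j)) ≈ sumTo b (λ j → sumTo a (λ i → f i j))
  sumTo-comm zero b f = sym (sumTo-0 b)
  sumTo-comm (suc a) b f = trans (+-congʳ (sumTo-comm a b f)) (sym (sumTo-+ b _ _))

module EmbeddingProperties {K L : FiniteField} (E : Embedding K L) where

  open import Data.Nat as ℕ using (zero; suc)
  import Data.Nat.Properties as ℕ
  open import Data.List using (List; map; length)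
  import Data.List.Properties as List
  open import Data.List.Relation.Unary.All as All using (All; _∷_)
  import Data.List.Relation.Unary.All.Properties as All
  open import Data.List.Relation.Unary.AllPairs using (_∷_)
  import Data.List.Membership.Setoid.Properties as ∈
  import Data.List.Relation.Unary.Unique.Setoid.Properties as Unique
  open import Relation.Nullary using (yes; no)
  open import Relation.Binary.PropositionalEquality as ≡ using (_≡_)
  open import Data.Empty using (⊥-elim)

  private
    module K = FiniteField K
    module K′ = FiniteFieldProperties K
  open FiniteField L hiding (size)
  open FiniteFieldProperties L
  open PolynomialFunctions L
  open Embedding E public
  open import Algebra.Properties.Semiring.Mult semiring using () renaming (_×_ to _·_)
  open import Algebra.Properties.Semiring.Mult K.semiring using () renaming (_×_ to _·ᴷ_)
  open import Relation.Binary.Reasoning.Setoid setoid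

  ι-0 : ι K.0# ≈ 0#
  ι-0 = begin
    ι K.0#                           ≈⟨ solve 1 (λ a → a := (a :+ a) :- a) refl (ι K.0#) ⟩
    (ι K.0# + ι K.0#) - ι K.0#       ≈⟨ +-congʳ (ι-+ K.0# K.0#) ⟨
    ι (K.0# K.+ K.0#) - ι K.0#       ≈⟨ +-congʳ (ι-cong (K.+-identityˡ K.0#)) ⟩
    ι K.0# - ι K.0#                  ≈⟨ -‿inverseʳ _ ⟩
    0#                               ∎

  ι-neg : ∀ a → ι (K.- a) ≈ - ι a
  ι-neg a = begin
    ι (K.- a)                        ≈⟨ solve 2 (λ u v → u := (v :+ u) :- v) refl (ι (K.- a)) (ι a) ⟩
    (ι a + ι (K.- a)) - ι a          ≈⟨ +-congʳ (ι-+ a (K.- a)) ⟨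
    ι (a K.+ K.- a) - ι a            ≈⟨ +-congʳ (trans (ι-cong (K.-‿inverseʳ a)) ι-0) ⟩
    0# - ι a                         ≈⟨ +-identityˡ _ ⟩
    - ι a                            ∎

  ι-injective : ∀ {a b} → ι a ≈ ι b → a K.≈ b
  ι-injective {a} {b} ιa≈ιb with a K.- b K′.≟ K.0#
  ... | yes a-b≈0 = K′.x-y≈0⇒x≈y a-b≈0
  ... | no a-b≉0 = ⊥-elim (0≉1 (begin
    0#                                   ≈⟨ zeroˡ _ ⟨
    0# * ι (K′.inv a-b≉0)                ≈⟨ *-congʳ ι[a-b]≈0 ⟨
    ι (a K.- b) * ι (K′.inv a-b≉0)       ≈⟨ ι-* _ _ ⟨
    ι ((a K.- b) K.* K′.inv a-b≉0)       ≈⟨ ι-cong (K′.*-inverseʳ a-b≉0) ⟩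
    ι K.1#                               ≈⟨ ι-1 ⟩
    1#                                   ∎))
    where
    ι[a-b]≈0 : ι (a K.- b) ≈ 0#
    ι[a-b]≈0 = trans (ι-+ a (K.- b)) (trans (+-congˡ (ι-neg b)) (trans (+-congʳ ιa≈ιb) (-‿inverseʳ _)))

  ι-^ : ∀ a k → ι (a K.^ k) ≈ ι a ^ k
  ι-^ a zero = ι-1
  ι-^ a (suc k) = trans (ι-* _ _) (*-congˡ (ι-^ a k))

  ι-· : ∀ k → ι (k ·ᴷ K.1#) ≈ k · 1#
  ι-· zero = ι-0
  ι-· (suc k) = trans (ι-+ _ _) (+-cong ι-1 (ι-· k))

  ι[a]^|K|≈ι[a] : ∀ a → ι a ^ K.size ≈ ι a
  ι[a]^|K|≈ι[a] a = trans (sym (ι-^ a K.size)) (ι-cong (K′.x^q≈x a))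

  private
    ι[K] : List Carrier
    ι[K] = map ι K′.elements

    ι[K]-Unique : Unique ι[K]
    ι[K]-Unique = Unique.map⁺ K.setoid setoid ι-injective K′.elements-Unique

    ∈-ι[K]⁻ : ∀ {t} → t ∈ ι[K] → ∃ λ a → t ≈ ι a
    ∈-ι[K]⁻ t∈ with ∈.∈-map⁻ K.setoid setoid t∈
    ... | a , _ , t≈ιa = a , t≈ιa

  -- ι[K] already provides |K| roots of the degree-|K| polynomial x^|K| - x.
  x^|K|≈x⇒∈ι[K] : ∀ {t} → t ^ K.size ≈ t → ∃ λ a → t ≈ ι a
  x^|K|≈x⇒∈ι[K] {t} t^q≈t with t ∈? ι[K]
  ... | yes t∈ = ∈-ι[K]⁻ t∈
  ... | no t∉ = ⊥-elim (ℕ.<-irrefl ≡.refl (ℕ.≤-trans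
    (ℕ.≤-reflexive (≡.cong suc (≡.sym |ι[K]|≡q)))
    (Monic⇒length-roots≤ (x^d-x-Monic K′.2≤q) (∈.∉⇒All[≉] setoid t∉ ∷ ι[K]-Unique)
      (trans (+-congʳ t^q≈t) (-‿inverseʳ t) ∷ roots))))
    where
    |ι[K]|≡q : length ι[K] ≡ K.size
    |ι[K]|≡q = ≡.trans (List.length-map ι K′.elements) K′.length-elements
    roots : All (λ x → x ^ K.size - x ≈ 0#) ι[K]
    roots = All.map⁺ (All.universal (λ a → trans (+-congʳ (ι[a]^|K|≈ι[a] a)) (-‿inverseʳ _)) K′.elements)


module FixedField (L : FiniteField) (Q : ℕ) (0<Q : 0 < Q)
                  (Q-additive : Characteristic.Additive L Q) where

  open import Data.List using (List; length; map; filter; lookup)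
  import Data.List.Properties as List
  open import Data.List.Relation.Unary.Any using (index)
  open import Data.List.Relation.Unary.Any.Properties using (lookup-index)
  import Data.List.Membership.Setoid as Membership
  import Data.List.Membership.Setoid.Properties as ∈
  import Data.List.Relation.Unary.Unique.Setoid.Properties as Unique
  open import Algebra.Morphism.Structures using (IsRingMonomorphism)
  import Algebra.Morphism.RingMonomorphism as RingMonomorphism
  open import Relation.Binary.PropositionalEquality as ≡ using (_≡_)

  open FiniteField L hiding (size)
  open FiniteFieldProperties L
  open Characteristic L using (0^k≈0)
  open import Relation.Binary.Reasoning.Setoid setoid

  Fixed : Carrier → Set
  Fixed x = x ^ Q ≈ x

  Fixed-resp : ∀ {x y} → x ≈ y → Fixed x → Fixed y
  Fixed-resp x≈y x-fixed = trans (^-cong Q (sym x≈y)) (trans x-fixed x≈y)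

  0-Fixed : Fixed 0#
  0-Fixed = 0^k≈0 0<Q

  1-Fixed : Fixed 1#
  1-Fixed = 1^n≈1 Q

  +-Fixed : ∀ {x y} → Fixed x → Fixed y → Fixed (x + y)
  +-Fixed x-fixed y-fixed = trans (Q-additive _ _) (+-cong x-fixed y-fixed)

  *-Fixed : ∀ {x y} → Fixed x → Fixed y → Fixed (x * y)
  *-Fixed x-fixed y-fixed = trans (^-distribʳ-* _ _ Q) (*-cong x-fixed y-fixed)

  -‿Fixed : ∀ {x} → Fixed x → Fixed (- x)
  -‿Fixed {x} x-fixed = trans (Characteristic.Additive⇒-^ L Q-additive 0<Q x) (-‿cong x-fixed)

  inv-Fixed : ∀ {x} (x≉0 : x ≉ 0#) → Fixed x → Fixed (inv x≉0)
  inv-Fixed {x} x≉0 x-fixed = *-cancelˡ x≉0 (begin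
    x * inv x≉0 ^ Q         ≈⟨ *-congʳ x-fixed ⟨
    x ^ Q * inv x≉0 ^ Q     ≈⟨ ^-distribʳ-* _ _ Q ⟨
    (x * inv x≉0) ^ Q       ≈⟨ ^-cong Q (*-inverseʳ x≉0) ⟩
    1# ^ Q                  ≈⟨ 1^n≈1 Q ⟩
    1#                      ≈⟨ *-inverseʳ x≉0 ⟨
    x * inv x≉0             ∎)

  FixedElement : Set
  FixedElement = Σ Carrier Fixed

  fixed : List Carrier
  fixed = filter (λ x → x ^ Q ≟ x) elements

  fixed-Unique : Unique fixed
  fixed-Unique = Unique.filter⁺ setoid _ elements-Unique

  ∈-fixed⁺ : ∀ {x} → Fixed x → x ∈ fixed
  ∈-fixed⁺ {x} = ∈.∈-filter⁺ setoid (λ x → x ^ Q ≟ x) Fixed-resp (∈-elements x)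

  ∈-fixed⁻ : ∀ {x} → x ∈ fixed → Fixed x
  ∈-fixed⁻ x∈ = proj₂ (∈.∈-filter⁻ setoid (λ x → x ^ Q ≟ x) Fixed-resp {xs = elements} x∈)

  private
    fixed-cring : CommutativeRing 0ℓ 0ℓ
    fixed-cring = record
      { Carrier = FixedElement
      ; _≈_ = λ a b → proj₁ a ≈ proj₁ b
      ; _+_ = λ (a , a-fixed) (b , b-fixed) → a + b , +-Fixed a-fixed b-fixed
      ; _*_ = λ (a , a-fixed) (b , b-fixed) → a * b , *-Fixed a-fixed b-fixed
      ; -_ = λ (a , a-fixed) → - a , -‿Fixed a-fixed
      ; 0# = 0# , 0-Fixed
      ; 1# = 1# , 1-Fixed
      ; isCommutativeRing = RingMonomorphism.isCommutativeRing proj₁-monomorphism isCommutativeRing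
      }
      where
      proj₁-monomorphism : IsRingMonomorphism _ (CommutativeRing.rawRing cring) proj₁
      proj₁-monomorphism = record
        { isRingHomomorphism = record
          { isSemiringHomomorphism = record
            { isNearSemiringHomomorphism = record
              { +-isMonoidHomomorphism = record
                { isMagmaHomomorphism = record { isRelHomomorphism = record { cong = λ e → e } ; homo = λ _ _ → refl }
                ; ε-homo = refl }
              ; *-homo = λ _ _ → refl }
            ; 1#-homo = refl }
          ; -‿homo = λ _ → refl }
        ; injective = λ e → e }

    module S = CommutativeRing fixed-cring
    open Membership S.setoid using () renaming (_∈_ to _∈ₛ_)

    fixed-elements : List FixedElement
    fixed-elements = Membership.mapWith∈ setoid fixed λ {x} x∈ → x , ∈-fixed⁻ x∈

    map-proj₁-fixed-elements : map proj₁ fixed-elements ≡ fixed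
    map-proj₁-fixed-elements = ≡.trans (∈.map-mapWith∈ setoid fixed _ proj₁) (∈.mapWith∈-id setoid fixed)

    fixed-elements-Unique : UniqueLists.Unique S.setoid fixed-elements
    fixed-elements-Unique = Unique.map⁻ S.setoid setoid (λ e → e)
      (≡.subst Unique (≡.sym map-proj₁-fixed-elements) fixed-Unique)

    ∈-fixed-elements : ∀ x → x ∈ₛ fixed-elements
    ∈-fixed-elements (x , x-fixed)
      with ∈.∈-map⁻ S.setoid setoid (≡.subst (x ∈_) (≡.sym map-proj₁-fixed-elements)
             (∈-fixed⁺ x-fixed))
    ... | y , y∈ , x≈y = ∈.∈-resp-≈ S.setoid {fixed-elements} {y} {x , x-fixed} (sym x≈y) y∈

  S : FiniteField
  S = record
    { cring = fixed-cring
    ; 0≉1 = 0≉1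
    ; inverse = λ (x , x-fixed) x≉0 → (inv x≉0 , inv-Fixed x≉0 x-fixed) , *-inverseʳ x≉0
    ; size = length fixed-elements
    ; enum = lookup fixed-elements
    ; enum-injective = λ i j → UniqueLists.lookup-injective S.setoid fixed-elements-Unique {i} {j}
    ; enum-surjective = λ x → index (∈-fixed-elements x) ,
        S.sym {x} {lookup fixed-elements (index (∈-fixed-elements x))} (lookup-index (∈-fixed-elements x))
    }

  S↪L : Embedding S L
  S↪L = record { ι = proj₁ ; ι-cong = λ e → e ; ι-+ = λ _ _ → refl ; ι-* = λ _ _ → refl ; ι-1 = refl }

  length-fixed : length fixed ≡ size S
  length-fixed = ≡.trans (≡.cong length (≡.sym map-proj₁-fixed-elements)) (List.length-map proj₁ fixed-elements)

module Tower {K L : FiniteField} {n : ℕ} (E : Extension K L n)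
             (r m : ℕ) .{{_ : NonZero r}} .{{_ : NonZero m}} (n≡r*m : n ≡ r Data.Nat.* m) where

  open import Data.Nat as ℕ using (suc; _<_; z≤n; s≤s)
  import Data.Nat.Properties as ℕ
  open import Data.List using (List; length; map)
  import Data.List.Properties as List
  open import Data.List.Relation.Unary.All as All using (All)
  import Data.List.Relation.Unary.All.Properties as All
  import Data.List.Membership.Setoid.Properties as ∈
  open import Data.Empty using (⊥-elim)
  open import Data.Sum using (_⊎_; inj₁; inj₂)
  open import Relation.Nullary using (yes; no)
  open import Relation.Binary.PropositionalEquality as ≡ using (_≡_)

  private
    module K = FiniteField K
    module K′ = FiniteFieldProperties K
  open FiniteField L hiding (size)
  open FiniteFieldProperties L hiding (q)
  open PolynomialFunctions L
  open Characteristic L using (Additive; Additive-^; Additive⇒sumTo-^; 0^k≈0; frobenius-Additive)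
  open Sums L
  open EmbeddingProperties (Extension.emb E)
  open import Relation.Binary.Reasoning.Setoid setoid

  q : ℕ
  q = size K

  Q : ℕ
  Q = q ℕ.^ m

  private instance
    q≢0 : ℕ.NonZero q
    q≢0 = ℕ.>-nonZero (ℕ.<-trans (s≤s z≤n) K′.2≤q)

  q-Additive : Additive q
  q-Additive with Characteristic.characteristic K
  ... | p , char@(p-prime , p·1≈0) with Characteristic.q≡p^e K char
  ...   | e , q≡p^e = ≡.subst Additive (≡.sym q≡p^e) (Additive-^ (frobenius-Additive (p-prime , ιp·1≈0)) e)
    where ιp·1≈0 = trans (sym (ι-· p)) (trans (ι-cong p·1≈0) ι-0)

  q^j-Additive : ∀ j → Additive (q ℕ.^ j)
  q^j-Additive = Additive-^ q-Additive

  0<q^j : ∀ j → 0 < q ℕ.^ j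
  0<q^j = ℕ.m^n>0 q

  q≤Q : q ℕ.≤ Q
  q≤Q = ℕ.≤-trans (ℕ.≤-reflexive (≡.sym (ℕ.*-identityʳ q))) (ℕ.^-monoʳ-≤ q {1} {m} (ℕ.>-nonZero⁻¹ m))

  2≤Q : 2 ℕ.≤ Q
  2≤Q = ℕ.≤-trans K′.2≤q q≤Q

  private instance
    Q≢0 : ℕ.NonZero Q
    Q≢0 = ℕ.>-nonZero (ℕ.<-trans (s≤s z≤n) 2≤Q)

  |L|≡Q^r : size L ≡ Q ℕ.^ r
  |L|≡Q^r = ≡.trans (Extension.card E) (≡.trans (≡.cong (q ℕ.^_) (≡.trans n≡r*m (ℕ.*-comm r m))) (≡.sym (ℕ.^-*-assoc q m r)))

  open FixedField L Q (ℕ.<-trans (s≤s z≤n) 2≤Q) (q^j-Additive m) public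

  private
    |S|≤Q : size S ℕ.≤ Q
    |S|≤Q = ℕ.≤-trans (ℕ.≤-reflexive (≡.sym length-fixed))
      (Monic⇒length-roots≤ (x^d-x-Monic 2≤Q) fixed-Unique
        (All.tabulateₛ setoid (λ x∈ → trans (+-congʳ (∈-fixed⁻ x∈)) (-‿inverseʳ _))))

    T : Carrier → Carrier
    T x = sumTo r (λ i → x ^ (Q ℕ.^ i))

    x^Q^i^Q≈x^Q^[1+i] : ∀ x i → (x ^ (Q ℕ.^ i)) ^ Q ≈ x ^ (Q ℕ.^ suc i)
    x^Q^i^Q≈x^Q^[1+i] x i = trans (^-*-assoc x (Q ℕ.^ i) Q) (reflexive (≡.cong (x ^_) (ℕ.*-comm (Q ℕ.^ i) Q)))

    T-Fixed : ∀ x → Fixed (T x)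
    T-Fixed x = begin
      T x ^ Q                                 ≈⟨ Additive⇒sumTo-^ (q^j-Additive m) (0<q^j m) r _ ⟩
      sumTo r (λ i → (x ^ (Q ℕ.^ i)) ^ Q)     ≈⟨ sumTo-cong r (λ i _ → x^Q^i^Q≈x^Q^[1+i] x i) ⟩
      sumTo r (λ i → x ^ (Q ℕ.^ suc i))       ≈⟨ sumTo-rotate r (λ i → x ^ (Q ℕ.^ i)) x^Q^r≈x^Q^0 ⟩
      T x                                     ∎
      where
      x^Q^r≈x^Q^0 : x ^ (Q ℕ.^ r) ≈ x ^ 1
      x^Q^r≈x^Q^0 = trans (reflexive (≡.cong (x ^_) (≡.sym |L|≡Q^r))) (trans (x^q≈x x) (sym (*-identityʳ x)))

    D : ℕ
    D = Q ℕ.^ ℕ.pred r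

    T-y-Monic : ∀ y → Monic D (λ x → T x - y)
    T-y-Monic y = monic
      (Degree<-+ (Degree<-sumTo (ℕ.pred r) (λ i x → x ^ (Q ℕ.^ i)) (λ i i<r-1 → Degree<-^ _ (ℕ.^-monoʳ-< Q 2≤Q i<r-1)))
                 (Degree<-neg (Degree<-mono (ℕ.m^n>0 Q (ℕ.pred r)) (Degree<-const {0} y))))
      λ x → trans (+-congʳ (reflexive (≡.cong (λ k → sumTo k (λ i → x ^ (Q ℕ.^ i))) (≡.sym (ℕ.suc-pred r)))))
                  (solve 3 (λ a b c → (a :+ b) :- c := b :+ (a :- c)) refl (sumTo (ℕ.pred r) (λ i → x ^ (Q ℕ.^ i))) (x ^ D) y)

    -- every fibre of T has at most D elements, so |L| = Q^r ≤ |S| · Q^(r-1)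
    Q≤|S| : Q ℕ.≤ size S
    Q≤|S| = ℕ.*-cancelʳ-≤ Q (size S) D {{ℕ.>-nonZero (ℕ.m^n>0 Q (ℕ.pred r))}}
      (ℕ.≤-trans (ℕ.≤-reflexive (≡.trans (≡.sym (≡.trans |L|≡Q^r (≡.cong (Q ℕ.^_) (≡.sym (ℕ.suc-pred r))))) (≡.sym length-elements)))
      (ℕ.≤-trans (Unique⇒length≤length*fibre T D fibre≤D fixed elements-Unique (All.universal (λ x → ∈-fixed⁺ (T-Fixed x)) elements))
                 (ℕ.≤-reflexive (≡.cong (ℕ._* D) length-fixed))))
      where
      fibre≤D : ∀ y {xs} → Unique xs → All (λ x → T x ≈ y) xs → length xs ℕ.≤ D
      fibre≤D y xs! Txs≈y = Monic⇒length-roots≤ (T-y-Monic y) xs! (All.map (λ Tx≈y → trans (+-congʳ Tx≈y) (-‿inverseʳ y)) Txs≈y)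

  |S|≡Q : size S ≡ Q
  |S|≡Q = ℕ.≤-antisym |S|≤Q Q≤|S|

  E′ : Extension S L r
  E′ = record { emb = S↪L ; card = ≡.trans |L|≡Q^r (≡.cong (ℕ._^ r) (≡.sym |S|≡Q)) }

  tr : Carrier → Carrier
  tr x = sumTo m (λ j → x ^ (q ℕ.^ j))

  tr-cong : ∀ {x y} → x ≈ y → tr x ≈ tr y
  tr-cong x≈y = sumTo-cong m (λ j _ → ^-cong (q ℕ.^ j) x≈y)

  tr-+ : ∀ x y → tr (x + y) ≈ tr x + tr y
  tr-+ x y = trans (sumTo-cong m (λ j _ → q^j-Additive j x y)) (sumTo-+ m _ _)

  tr-0 : tr 0# ≈ 0#
  tr-0 = trans (sumTo-cong m (λ j _ → 0^k≈0 (0<q^j j))) (sumTo-0 m)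

  tr-ι* : ∀ c x → tr (ι c * x) ≈ ι c * tr x
  tr-ι* c x = begin
    tr (ι c * x)                                  ≈⟨ sumTo-cong m (λ j _ → ^-distribʳ-* (ι c) x (q ℕ.^ j)) ⟩
    sumTo m (λ j → ι c ^ (q ℕ.^ j) * x ^ (q ℕ.^ j)) ≈⟨ sumTo-cong m (λ j _ → *-congʳ (x^k≈x⇒x^k^j≈x q (ι[a]^|K|≈ι[a] c) j)) ⟩
    sumTo m (λ j → ι c * x ^ (q ℕ.^ j))           ≈⟨ *-distribˡ-sumTo m (ι c) _ ⟨
    ι c * tr x                                    ∎

  tr-sub : ∀ x y → tr (x - y) ≈ tr x - tr y
  tr-sub x y = begin
    tr (x - y)                       ≈⟨ solve 2 (λ a b → a := (a :+ b) :- b) refl (tr (x - y)) (tr y) ⟩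
    (tr (x - y) + tr y) - tr y       ≈⟨ +-congʳ (tr-+ (x - y) y) ⟨
    tr ((x - y) + y) - tr y          ≈⟨ +-congʳ (tr-cong (solve 2 (λ x y → (x :- y) :+ y := x) refl x y)) ⟩
    tr x - tr y                      ∎

  tr-Fixed⇒∈ι[K] : ∀ {x} → Fixed x → ∃ λ a → tr x ≈ ι a
  tr-Fixed⇒∈ι[K] {x} x-fixed = x^|K|≈x⇒∈ι[K] (begin
    tr x ^ q                                   ≈⟨ Additive⇒sumTo-^ q-Additive (ℕ.>-nonZero⁻¹ q) m _ ⟩
    sumTo m (λ j → (x ^ (q ℕ.^ j)) ^ q)        ≈⟨ sumTo-cong m (λ j _ → trans (^-*-assoc x (q ℕ.^ j) q)
                                                      (reflexive (≡.cong (x ^_) (ℕ.*-comm (q ℕ.^ j) q)))) ⟩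
    sumTo m (λ j → x ^ (q ℕ.^ suc j))          ≈⟨ sumTo-rotate m (λ j → x ^ (q ℕ.^ j)) (trans x-fixed (sym (*-identityʳ x))) ⟩
    tr x                                       ∎)

  private
    tr-Monic : Monic (q ℕ.^ ℕ.pred m) tr
    tr-Monic = monic
      (Degree<-sumTo (ℕ.pred m) (λ j x → x ^ (q ℕ.^ j)) (λ j j<m-1 → Degree<-^ (q ℕ.^ j) (ℕ.^-monoʳ-< q K′.2≤q j<m-1)))
      λ x → trans (reflexive (≡.cong (λ k → sumTo k (λ j → x ^ (q ℕ.^ j))) (≡.sym (ℕ.suc-pred m)))) (+-comm _ _)

    q^[m-1]<Q : q ℕ.^ ℕ.pred m < Q
    q^[m-1]<Q = ℕ.<-≤-trans (ℕ.^-monoʳ-< q K′.2≤q (ℕ.n<1+n (ℕ.pred m))) (ℕ.≤-reflexive (≡.cong (q ℕ.^_) (ℕ.suc-pred m)))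

    ∃tr≉0 : ∃ λ γ → Fixed γ × tr γ ≉ 0#
    ∃tr≉0 with All-or-counterexample (λ x → tr x ≟ 0#) fixed
    ... | inj₂ (γ , γ∈ , trγ≉0) = γ , ∈-fixed⁻ γ∈ , trγ≉0
    ... | inj₁ tr≈0 = ⊥-elim (ℕ.<-irrefl ≡.refl (ℕ.<-≤-trans q^[m-1]<Q (ℕ.≤-trans
          (ℕ.≤-reflexive (≡.trans (≡.sym |S|≡Q) (≡.sym length-fixed)))
          (Monic⇒length-roots≤ tr-Monic fixed-Unique tr≈0))))

    γ₀ : Carrier
    γ₀ = proj₁ ∃tr≉0

    γ₀-Fixed : Fixed γ₀
    γ₀-Fixed = proj₁ (proj₂ ∃tr≉0)

    a₀ : K.Carrier
    a₀ = proj₁ (tr-Fixed⇒∈ι[K] γ₀-Fixed)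

    a₀≉0 : a₀ K.≉ K.0#
    a₀≉0 a₀≈0 = proj₂ (proj₂ ∃tr≉0) (trans (proj₂ (tr-Fixed⇒∈ι[K] γ₀-Fixed)) (trans (ι-cong a₀≈0) ι-0))

    _/a₀ : K.Carrier → K.Carrier
    b /a₀ = b K.* K′.inv a₀≉0

    ι*γ₀-Fixed : ∀ c → Fixed (ι c * γ₀)
    ι*γ₀-Fixed c = *-Fixed (x^k≈x⇒x^k^j≈x q (ι[a]^|K|≈ι[a] c) m) γ₀-Fixed

    tr[ι[b/a₀]*γ₀]≈ιb : ∀ b → tr (ι (b /a₀) * γ₀) ≈ ι b
    tr[ι[b/a₀]*γ₀]≈ιb b = begin
      tr (ι (b /a₀) * γ₀)       ≈⟨ tr-ι* (b /a₀) γ₀ ⟩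
      ι (b /a₀) * tr γ₀         ≈⟨ *-congˡ (proj₂ (tr-Fixed⇒∈ι[K] γ₀-Fixed)) ⟩
      ι (b /a₀) * ι a₀          ≈⟨ ι-* (b /a₀) a₀ ⟨
      ι ((b /a₀) K.* a₀)        ≈⟨ ι-cong b/a₀*a₀≈b ⟩
      ι b                       ∎
      where
      b/a₀*a₀≈b : (b /a₀) K.* a₀ K.≈ b
      b/a₀*a₀≈b = K.trans (K.*-assoc _ _ _) (K.trans (K.*-congˡ (K.trans (K.*-comm _ _) (K′.*-inverseʳ a₀≉0))) (K.*-identityʳ b))

  tr-onto-≉0 : ∀ β → β K.≉ K.0# → ∃ λ γ → Fixed γ × γ ≉ 0# × tr γ ≈ ι β
  tr-onto-≉0 β β≉0 = ι (β /a₀) * γ₀ , ι*γ₀-Fixed (β /a₀) , γ≉0 , tr[ι[b/a₀]*γ₀]≈ιb β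
    where
    γ≉0 : ι (β /a₀) * γ₀ ≉ 0#
    γ≉0 γ≈0 = β≉0 (ι-injective (trans (sym (tr[ι[b/a₀]*γ₀]≈ιb β)) (trans (tr-cong γ≈0) (trans tr-0 (sym ι-0)))))

  module _ (1<m : 1 < m) where

    private
      q<Q : q < Q
      q<Q = ℕ.≤-<-trans (ℕ.≤-reflexive (≡.sym (ℕ.*-identityʳ q))) (ℕ.^-monoʳ-< q K′.2≤q 1<m)

      Kγ₀ : List Carrier
      Kγ₀ = map (λ c → ι c * γ₀) K′.elements

      -- As |S| > |K|, some y ∈ S lies off the K-line through γ₀; subtract its projection onto that line.
      tr-kernel : ∃ λ κ → Fixed κ × κ ≉ 0# × tr κ ≈ 0#
      tr-kernel with All-or-counterexample (λ y → y ∈? Kγ₀) fixed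
      ... | inj₁ fixed⊆Kγ₀ = ⊥-elim (ℕ.<-irrefl ≡.refl (ℕ.<-≤-trans q<Q (ℕ.≤-trans
            (ℕ.≤-reflexive (≡.trans (≡.sym |S|≡Q) (≡.sym length-fixed)))
            (ℕ.≤-trans (Unique∧⊆⇒length≤ fixed-Unique (All.lookupₛ setoid ∈-resp-≈ fixed⊆Kγ₀))
                       (ℕ.≤-reflexive (≡.trans (List.length-map _ K′.elements) K′.length-elements))))))
      ... | inj₂ (y , y∈ , y∉Kγ₀) = κ , κ-Fixed , κ≉0 , trκ≈0
        where
        b = proj₁ (tr-Fixed⇒∈ι[K] (∈-fixed⁻ y∈))
        κ = y - ι (b /a₀) * γ₀
        κ-Fixed : Fixed κ
        κ-Fixed = +-Fixed (∈-fixed⁻ y∈) (-‿Fixed (ι*γ₀-Fixed (b /a₀)))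
        κ≉0 : κ ≉ 0#
        κ≉0 κ≈0 = y∉Kγ₀ (∈-resp-≈ (sym (x-y≈0⇒x≈y κ≈0)) (∈.∈-map⁺ K.setoid setoid (λ c≈d → *-congʳ (ι-cong c≈d)) (K′.∈-elements (b /a₀))))
        trκ≈0 : tr κ ≈ 0#
        trκ≈0 = begin
          tr κ                                     ≈⟨ tr-sub y (ι (b /a₀) * γ₀) ⟩
          tr y - tr (ι (b /a₀) * γ₀)               ≈⟨ +-cong (proj₂ (tr-Fixed⇒∈ι[K] (∈-fixed⁻ y∈))) (-‿cong (tr[ι[b/a₀]*γ₀]≈ιb b)) ⟩
          ι b - ι b                                ≈⟨ -‿inverseʳ (ι b) ⟩
          0#                                       ∎

    tr-onto : ∀ β → ∃ λ γ → Fixed γ × γ ≉ 0# × tr γ ≈ ι β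
    tr-onto β with β K′.≟ K.0#
    ... | no β≉0 = tr-onto-≉0 β β≉0
    ... | yes β≈0 with tr-kernel
    ...   | κ , κ-Fixed , κ≉0 , trκ≈0 = κ , κ-Fixed , κ≉0 , trans trκ≈0 (sym (trans (ι-cong β≈0) ι-0))

  Tr-tower : ∀ ξ → Tr E ξ ≈ tr (Tr E′ ξ)
  Tr-tower ξ = begin
    sumTo n f                                                 ≡⟨ ≡.cong (λ k → sumTo k f) n≡r*m ⟩
    sumTo (r ℕ.* m) f                                         ≈⟨ sumTo-*-index r m f ⟩
    sumTo r (λ i → sumTo m (λ j → f (i ℕ.* m ℕ.+ j)))         ≈⟨ sumTo-comm r m _ ⟩
    sumTo m (λ j → sumTo r (λ i → f (i ℕ.* m ℕ.+ j)))         ≈⟨ sumTo-cong m (λ j _ → sumTo-cong r (λ i _ → reflexive (≡.cong (ξ ^_) (q^[im+j]≡Q^i*q^j i j)))) ⟩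
    sumTo m (λ j → sumTo r (λ i → ξ ^ (Q ℕ.^ i ℕ.* q ℕ.^ j))) ≈⟨ sumTo-cong m (λ j _ → sumTo-cong r (λ i _ → ^-*-assoc ξ (Q ℕ.^ i) (q ℕ.^ j))) ⟨
    sumTo m (λ j → sumTo r (λ i → (ξ ^ (Q ℕ.^ i)) ^ (q ℕ.^ j))) ≈⟨ sumTo-cong m (λ j _ → Additive⇒sumTo-^ (q^j-Additive j) (0<q^j j) r _) ⟨
    tr (sumTo r (λ i → ξ ^ (Q ℕ.^ i)))                        ≡⟨ ≡.cong (λ s → tr (sumTo r (λ i → ξ ^ (s ℕ.^ i)))) |S|≡Q ⟨
    tr (Tr E′ ξ)                                              ∎
    where
    f : ℕ → Carrier
    f k = ξ ^ (q ℕ.^ k)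
    q^[im+j]≡Q^i*q^j : ∀ i j → q ℕ.^ (i ℕ.* m ℕ.+ j) ≡ Q ℕ.^ i ℕ.* q ℕ.^ j
    q^[im+j]≡Q^i*q^j i j = ≡.trans (ℕ.^-distribˡ-+-* q (i ℕ.* m) j)
      (≡.cong (ℕ._* q ℕ.^ j) (≡.trans (≡.cong (q ℕ.^_) (ℕ.*-comm i m)) (≡.sym (ℕ.^-*-assoc q m i))))

  HasTrace-tower : ∀ {ξ β} (γ : FixedElement) → HasTrace E′ ξ γ → tr (proj₁ γ) ≈ ι β → HasTrace E ξ β
  HasTrace-tower {ξ} γ Tr′ξ≈γ trγ≈ιβ = trans (Tr-tower ξ) (trans (tr-cong Tr′ξ≈γ) trγ≈ιβ)

  witness-descends : ∀ {β} {X : Carrier → Set} (γ : FixedElement) → tr (proj₁ γ) ≈ ι β →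
    (∃ λ ξ → X ξ × HasTrace E′ ξ γ) → ∃ λ ξ → X ξ × HasTrace E ξ β
  witness-descends γ trγ≈ιβ (ξ , Xξ , Tr′ξ≈γ) = ξ , Xξ , HasTrace-tower γ Tr′ξ≈γ trγ≈ιβ

  module _ (q≡3 : q ≡ 3) (m≡2 : m ≡ 2) where

    open import Algebra.Properties.Semiring.Mult semiring using () renaming (_×_ to _·_)
    open import Algebra.Properties.Semiring.Mult K.semiring using () renaming (_×_ to _·ᴷ_)
    open import Algebra.Properties.Ring ring using (-‿distribʳ-*)
    open import Data.Integer using (+_)

    private
      3·1≈0 : 3 · 1# ≈ 0#
      3·1≈0 with Characteristic.characteristic K
      ... | p , char = trans (sym (ι-· 3)) (trans (ι-cong (≡.subst (λ k → k ·ᴷ K.1# K.≈ K.0#) q≡3 (Characteristic.q·1≈0 K char))) ι-0)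

      tr≈x+x³ : ∀ x → tr x ≈ x + x ^ 3
      tr≈x+x³ x = begin
        tr x                    ≡⟨ ≡.cong₂ (λ a b → sumTo b (λ j → x ^ (a ℕ.^ j))) q≡3 m≡2 ⟩
        (0# + x ^ 1) + x ^ 3    ≈⟨ +-congʳ (trans (+-identityˡ _) (*-identityʳ x)) ⟩
        x + x ^ 3               ∎

      β[β-1][β+1]≈0 : ∀ β → β K.* ((β K.- K.1#) K.* (β K.+ K.1#)) K.≈ K.0#
      β[β-1][β+1]≈0 β = K.trans
        (K′.solve 2 (λ b o → b K′.:* ((b K′.:- o) K′.:* (b K′.:+ o)) K′.:= b K′.:* (b K′.:* b) K′.:- b K′.:* (o K′.:* o)) K.refl β K.1#)
        (K.trans (K.+-cong β*[β*β]≈β (K.-‿cong (K.trans (K.*-congˡ (K.*-identityʳ K.1#)) (K.*-identityʳ β)))) (K.-‿inverseʳ β))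
        where
        β*[β*β]≈β : β K.* (β K.* β) K.≈ β
        β*[β*β]≈β = K.trans (K.*-congˡ (K.*-congˡ (K.sym (K.*-identityʳ β)))) (≡.subst (λ k → β K.^ k K.≈ β) q≡3 (K′.x^q≈x β))

      K-elements : ∀ β → β K.≈ K.0# ⊎ β K.≈ K.1# ⊎ β K.≈ K.- K.1#
      K-elements β with K′.x*y≈0⇒x≈0∨y≈0 (β[β-1][β+1]≈0 β)
      ... | inj₁ β≈0 = inj₁ β≈0
      ... | inj₂ [β-1][β+1]≈0 with K′.x*y≈0⇒x≈0∨y≈0 [β-1][β+1]≈0
      ...   | inj₁ β-1≈0 = inj₂ (inj₁ (K′.x-y≈0⇒x≈y β-1≈0))
      ...   | inj₂ β+1≈0 = inj₂ (inj₂ (K′.x-y≈0⇒x≈y (K.trans (K.+-congˡ (-‿involutive K.1#)) β+1≈0)))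
        where open import Algebra.Properties.Ring K.ring using (-‿involutive)

      -- an element x ∈ 𝔽₉ with x⁵ ≠ x has x⁸ = 1 ≠ x⁴, so x⁴ = -1
      ∃i : ∃ λ i → Fixed i × i * i ≈ - 1#
      ∃i with All-or-counterexample (λ x → x ^ 5 - x ≟ 0#) fixed
      ... | inj₁ x⁵≈x = ⊥-elim (ℕ.<⇒≱ (ℕ.m<n+m 5 {4} (s≤s z≤n)) (ℕ.≤-trans
            (ℕ.≤-reflexive (≡.trans (≡.sym Q≡9) (≡.trans (≡.sym |S|≡Q) (≡.sym length-fixed))))
            (Monic⇒length-roots≤ (x^d-x-Monic {5} (s≤s (s≤s z≤n))) fixed-Unique x⁵≈x)))
        where
        Q≡9 : Q ≡ 9
        Q≡9 = ≡.cong₂ ℕ._^_ q≡3 m≡2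
      ... | inj₂ (x , x∈ , x⁵-x≉0) = x ^ 2 , *-Fixed x-Fixed (*-Fixed x-Fixed 1-Fixed) , x²x²≈-1
        where
        x-Fixed = ∈-fixed⁻ x∈
        x⁵≉x : x ^ 5 ≉ x
        x⁵≉x x⁵≈x = x⁵-x≉0 (trans (+-congʳ x⁵≈x) (-‿inverseʳ x))
        x≉0 : x ≉ 0#
        x≉0 x≈0 = x⁵≉x (trans (^-cong 5 x≈0) (trans (0^[1+n]≈0 4) (sym x≈0)))
        z = x ^ 4
        z*z≈1 : z * z ≈ 1#
        z*z≈1 = *-cancelˡ x≉0 (begin
          x * (z * z)       ≈⟨ *-congˡ (^-distribˡ-+-* x 4 4) ⟨
          x ^ 9             ≡⟨ ≡.cong₂ (λ a b → x ^ (a ℕ.^ b)) q≡3 m≡2 ⟨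
          x ^ Q             ≈⟨ x-Fixed ⟩
          x                 ≈⟨ *-identityʳ x ⟨
          x * 1#            ∎)
        z≈-1 : z ≈ - 1#
        z≈-1 with x*y≈0⇒x≈0∨y≈0 (trans (solve 2 (λ z o → (z :+ o) :* (z :- o) := z :* z :- o :* o) refl z 1#)
                                        (trans (+-cong z*z≈1 (-‿cong (*-identityʳ 1#))) (-‿inverseʳ 1#)))
        ... | inj₁ z+1≈0 = trans (solve 2 (λ z o → z := (z :+ o) :- o) refl z 1#) (trans (+-congʳ z+1≈0) (+-identityˡ _))
        ... | inj₂ z-1≈0 = ⊥-elim (x⁵≉x (trans (*-congˡ (x-y≈0⇒x≈y z-1≈0)) (*-identityʳ x)))
        x²x²≈-1 : x ^ 2 * x ^ 2 ≈ - 1#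
        x²x²≈-1 = trans (sym (^-distribˡ-+-* x 2 2)) z≈-1

    tr-onto-±1±i : ∀ β → ∃ λ γ → Fixed γ × (γ ≈ 1# ⊎ γ ≈ - 1# ⊎ γ * γ ≈ - 1#) × tr γ ≈ ι β
    tr-onto-±1±i β with K-elements β
    ... | inj₁ β≈0 = i , i-Fixed , inj₂ (inj₂ i*i≈-1) , (begin
      tr i                           ≈⟨ tr≈x+x³ i ⟩
      i + i * (i * (i * 1#))         ≈⟨ +-congˡ (*-congˡ (trans (*-congˡ (*-identityʳ i)) i*i≈-1)) ⟩
      i + i * - 1#                   ≈⟨ +-congˡ (trans (sym (-‿distribʳ-* i 1#)) (-‿cong (*-identityʳ i))) ⟩
      i - i                          ≈⟨ -‿inverseʳ i ⟩
      0#                             ≈⟨ trans (ι-cong β≈0) ι-0 ⟨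
      ι β                            ∎)
      where
      i = proj₁ ∃i
      i-Fixed = proj₁ (proj₂ ∃i)
      i*i≈-1 = proj₂ (proj₂ ∃i)
    ... | inj₂ (inj₁ β≈1) = - 1# , -‿Fixed 1-Fixed , inj₂ (inj₁ refl) , (begin
      tr (- 1#)                      ≈⟨ tr≈x+x³ (- 1#) ⟩
      - 1# + (- 1#) ^ 3              ≈⟨ +-congˡ (trans (Characteristic.Additive⇒-^ L {3} (≡.subst Additive q≡3 q-Additive) (s≤s z≤n) 1#) (-‿cong (1^n≈1 3))) ⟩
      - 1# + - 1#                    ≈⟨ solve 1 (λ o → :- o :+ :- o := o :- con (+ 3) :* o) refl 1# ⟩
      1# - 3 · 1# * 1#               ≈⟨ +-congˡ (-‿cong (trans (*-identityʳ _) 3·1≈0)) ⟩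
      1# - 0#                        ≈⟨ solve 1 (λ o → o :- con (+ 0) := o) refl 1# ⟩
      1#                             ≈⟨ trans (ι-cong β≈1) ι-1 ⟨
      ι β                            ∎)
    ... | inj₂ (inj₂ β≈-1) = 1# , 1-Fixed , inj₁ refl , (begin
      tr 1#                          ≈⟨ tr≈x+x³ 1# ⟩
      1# + 1# ^ 3                    ≈⟨ +-congˡ (1^n≈1 3) ⟩
      1# + 1#                        ≈⟨ solve 1 (λ o → o :+ o := :- o :+ con (+ 3) :* o) refl 1# ⟩
      - 1# + 3 · 1# * 1#             ≈⟨ +-congˡ (trans (*-identityʳ _) 3·1≈0) ⟩
      - 1# + 0#                      ≈⟨ +-identityʳ _ ⟩
      - 1#                           ≈⟨ trans (ι-cong β≈-1) (trans (ι-neg K.1#) (-‿cong ι-1)) ⟨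
      ι β                            ∎)

module PrimeDegreeReduction where

  open import Data.Nat.Primality using (prime?; prime[2]; prime⇒nonZero; prime⇒nonTrivial)
  open import Data.Nat.Divisibility using (_∣_; ∣n⇒∣m*n; ∣-refl)
  open import Data.Sum using (_⊎_; inj₁; inj₂; [_,_]′)
  open import Data.Empty using (⊥-elim)
  open import Relation.Nullary using (¬_; yes; no)
  open import Relation.Nullary.Decidable using (from-yes)
  open import Relation.Binary.PropositionalEquality using (sym; trans; subst; _≢_)
  import Data.Nat as ℕ
  import Data.Nat.Properties as ℕ
  open NatFacts

  P₁-from-prime-degrees :
    (∀ (K L : FiniteField) (n : ℕ) (E : Extension K L n) → Prime n → P₁ E) →
    ∀ (K L : FiniteField) (n : ℕ) (E : Extension K L n) → 2 ≤ n → P₁ E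
  P₁-from-prime-degrees P₁-prime K L n E 2≤n with prime? n
  ... | yes n-prime = P₁-prime K L n E n-prime
  ... | no ¬n-prime with composite-factorisation′ 2≤n ¬n-prime
  ...   | r , m , r-prime , 2≤m , n≡r*m , r≡2⊎2∤n = λ β _ _ →
    let (γ , γ-Fixed , γ≉0 , trγ≈ιβ) = T.tr-onto 2≤m β
    in T.witness-descends (γ , γ-Fixed) trγ≈ιβ
         (P₁-prime T.S L r T.E′ r-prime (γ , γ-Fixed) (λ (_ , γ≈0) → γ≉0 γ≈0) ¬[r≡3×|S|≡4])
    where
    instance
      _ = prime⇒nonZero r-prime
      _ = ℕ.>-nonZero (ℕ.<-trans ℕ.z<s 2≤m)
    module T = Tower E r m n≡r*m
    ¬[r≡3×|S|≡4] : ¬ (r ≡ 3 × size T.S ≡ 4)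
    ¬[r≡3×|S|≡4] (r≡3 , |S|≡4) = [ (λ r≡2 → ℕ.<-irrefl (trans (sym r≡2) r≡3) (ℕ.n<1+n 2)) ,
                                     (λ 2∤n → 2∤n (subst (2 ∣_) (sym n≡r*m) (∣n⇒∣m*n r (subst (2 ∣_) (sym m≡2) ∣-refl)))) ]′ r≡2⊎2∤n
      where m≡2 = q^m≡4⇒m≡2 (FiniteFieldProperties.2≤q K) 2≤m (trans (sym T.|S|≡Q) |S|≡4)

  ¬Exceptional : ∀ {K L n} (E : Extension K L n) {v} → ¬ Prime v → v ≢ 9 → ¬ Exceptional E v
  ¬Exceptional E ¬v-prime v≢9 (inj₁ v≡3) = ¬v-prime (subst Prime (sym v≡3) (from-yes (prime? 3)))
  ¬Exceptional E ¬v-prime v≢9 (inj₂ (inj₁ v≡5)) = ¬v-prime (subst Prime (sym v≡5) (from-yes (prime? 5)))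
  ¬Exceptional E ¬v-prime v≢9 (inj₂ (inj₂ (inj₁ v≡7))) = ¬v-prime (subst Prime (sym v≡7) (from-yes (prime? 7)))
  ¬Exceptional E ¬v-prime v≢9 (inj₂ (inj₂ (inj₂ (inj₁ v≡9)))) = v≢9 v≡9
  ¬Exceptional E ¬v-prime v≢9 (inj₂ (inj₂ (inj₂ (inj₂ (inj₁ v≡11))))) = ¬v-prime (subst Prime (sym v≡11) (from-yes (prime? 11)))
  ¬Exceptional E ¬v-prime v≢9 (inj₂ (inj₂ (inj₂ (inj₂ (inj₂ (inj₁ v≡13)))))) = ¬v-prime (subst Prime (sym v≡13) (from-yes (prime? 13)))
  ¬Exceptional E ¬v-prime v≢9 (inj₂ (inj₂ (inj₂ (inj₂ (inj₂ (inj₂ v≡31)))))) = ¬v-prime (subst Prime (sym v≡31) (from-yes (prime? 31)))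

  P₂-from-prime-degrees :
    (∀ (K L : FiniteField) (n : ℕ) (E : Extension K L n) → Odd (size K) → Prime n → P₂ E) →
    ∀ (K L : FiniteField) (n : ℕ) (E : Extension K L n) → Odd (size K) → 2 ≤ n → P₂ E
  P₂-from-prime-degrees P₂-prime K L n E q-odd 2≤n with prime? n
  ... | yes n-prime = P₂-prime K L n E q-odd n-prime
  ... | no ¬n-prime with composite-factorisation 2≤n ¬n-prime
  ...   | r , m , r-prime , 2≤m , n≡r*m = (λ _ → descend) , (λ n≡2 → ⊥-elim (¬n≡2 n≡2)) , (λ n≡2 → ⊥-elim (¬n≡2 n≡2))
    where
    instance
      _ = prime⇒nonZero r-prime
      _ = ℕ.>-nonZero (ℕ.<-trans ℕ.z<s 2≤m)
    module T = Tower E r m n≡r*m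
    ¬n≡2 : n ≢ 2
    ¬n≡2 n≡2 = ¬n-prime (subst Prime (sym n≡2) prime[2])
    P₂S : P₂ T.E′
    P₂S = P₂-prime T.S L r T.E′ (subst Odd (sym T.|S|≡Q) (Odd-^ q-odd m)) r-prime
    3≤q : 3 ≤ T.q
    3≤q = Odd∧2≤⇒3≤ q-odd (FiniteFieldProperties.2≤q K)
    descend : ∀ β → ∃ λ ξ → TwoPrimitive E ξ × HasTrace E ξ β
    descend β with r ℕ.≟ 2 | T.Q ℕ.≟ 9
    ... | no r≢2 | _ =
      let (γ , γ-Fixed , _ , trγ≈ιβ) = T.tr-onto 2≤m β
      in T.witness-descends (γ , γ-Fixed) trγ≈ιβ (proj₁ P₂S 3≤r (γ , γ-Fixed))
      where 3≤r = ℕ.≤∧≢⇒< (ℕ.nonTrivial⇒n>1 r {{prime⇒nonTrivial r-prime}}) (λ 2≡r → r≢2 (sym 2≡r))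
    ... | yes r≡2 | no Q≢9 =
      let (γ , γ-Fixed , γ≉0 , trγ≈ιβ) = T.tr-onto 2≤m β
      in T.witness-descends (γ , γ-Fixed) trγ≈ιβ (proj₁ (proj₂ P₂S) r≡2 ¬Exceptional-S (γ , γ-Fixed) γ≉0)
      where
      ¬Exceptional-S = subst (λ v → ¬ Exceptional T.E′ v) (sym T.|S|≡Q)
        (¬Exceptional T.E′ (^-¬prime (ℕ.≤-trans (ℕ.n≤1+n 2) 3≤q) 2≤m) Q≢9)
    ... | yes r≡2 | yes Q≡9 =
      let (q≡3 , m≡2) = q^m≡9⇒q≡3∧m≡2 3≤q 2≤m Q≡9
          (γ , γ-Fixed , γ∈±1±i , trγ≈ιβ) = T.tr-onto-±1±i q≡3 m≡2 β
      in T.witness-descends (γ , γ-Fixed) trγ≈ιβ (proj₂ (proj₂ P₂S) r≡2 (trans T.|S|≡Q Q≡9) (γ , γ-Fixed) γ∈±1±i)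

open PrimeDegreeReduction using (P₁-from-prime-degrees; P₂-from-prime-degrees)

lemma2p1 : ((∀ (K L : FiniteField) (n : ℕ) (E : Extension K L n) → Prime n → P₁ E) →
    ∀ (K L : FiniteField) (n : ℕ) (E : Extension K L n) → 2 ≤ n → P₁ E)
    ×
    ((∀ (K L : FiniteField) (n : ℕ) (E : Extension K L n) → Odd (size K) → Prime n → P₂ E) →
    ∀ (K L : FiniteField) (n : ℕ) (E : Extension K L n) → Odd (size K) → 2 ≤ n → P₂ E)
lemma2p1 = P₁-from-prime-degrees , P₂-from-prime-degrees
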